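{- Let $\mathcal{N}=\mathcal{N}(P,E)$ be a ported unimodular oriented matroid. Then $\mathbf{M}_E(\mathcal{N})$ equals the element of the exterior algebra obtained from the polynomial $R(\mathcal{N}(P,E))$ by substituting $u=0$, $v=0$ and, in each term, replacing the monomial $[\mathcal{N}/A|P]$ by the extensor $\epsilon(P)\,\epsilon(PE)\,\mathbf{M}_\emptyset(\mathbf{L}_A)$, where $\mathbf{L}_A$ is a unimodular extensor with ground set $P$ presenting the oriented matroid $\mathcal{N}/A|P$ (the result does not depend on the sign choice $\pm\mathbf{L}_A$).
   Context: $K\subseteq\mathbb{R}$ is a field, extended by parameters $g_e,r_e$ ($e\in E$); $g_A=\prod_{e\in A}g_e$. For a finite set $S$, $\mathcal{E}(KS)$ is the exterior algebra over $KS$ with basis $S$; for a sequence $A$ of distinct elements, $\mathbf{A}$ is the product of their images in order. Set symbols denote sequences in an arbitrary order; $AB$ is concatenation; $\bar X$ is the complement in the ground set. An extensor with ground set $S$ is an element of $\mathcal{E}(KS)$ that is a scalar multiple of $\mathbf{1}$ or an exterior product of vectors; its Plücker coordinates are the alternating function $\mathbf{N}[A]$ with $\mathbf{N}=\sum_A\mathbf{N}[A]\mathbf{A}$. A nonzero extensor presents the oriented matroid on $S$ whose chirotope is $B\mapsto\mathrm{sign}\,\mathbf{N}[B]$; it is unimodular if all its Plücker coordinates lie in $\{0,\pm1\}$; every unimodular (regular) oriented matroid is presented by exactly two unimodular extensors $\pm\mathbf{N}$. Contraction: $(\mathbf{N}/e)[B]=\mathbf{N}[Be]$, $\mathbf{N}/X=\mathbf{N}/x_k/\cdots/x_1$.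 A ground set orientation $\epsilon$ is an alternating function on finite sequences of ground set elements into $\{1,-1,0\}$, nonzero on sequences of distinct elements, $\epsilon(\emptyset)=1$; canonical dual $\mathbf{N}^\perp[X]=\mathbf{N}[\bar X]\epsilon(\bar X X)$. A ported extensor $\mathbf{N}(P,E)$ has ground set $P\sqcup E$; $P_\iota,P_\upsilon$ are disjoint copies of $P$; $\iota_g,\upsilon_r$ are the algebra homomorphisms induced by $\mathbf{e}\mapsto g_e\mathbf{e},\ \mathbf{p}\mapsto\mathbf{p}_\iota$ and $\mathbf{e}\mapsto r_e\mathbf{e},\ \mathbf{p}\mapsto\mathbf{p}_\upsilon$; $\mathbf{M}(\mathbf{N})=\iota_g(\mathbf{N})\upsilon_r(\mathbf{N}^\perp)$ and, with $E$ a fixed sequence, $\mathbf{M}_E(\mathbf{N})=\mathbf{M}(\mathbf{N})/E$. For a ported unimodular oriented matroid $\mathcal{N}(P,E)$ (an oriented matroid on $P\sqcup E$ with distinguished subset $P$ of ports), $\mathbf{M}_E(\mathcal{N}):=\mathbf{M}_E(\mathbf{N})$ where $\pm\mathbf{N}$ are its unimodular presentations. For $A\subseteq E$, $\mathcal{N}/A|P$ is the oriented minor obtained by contracting $A$ and deleting $E\setminus A$. The polynomial $R$: for every connected oriented matroid $\mathcal{Q}$ whose ground set is a nonempty subset of $P$ there is a commuting variable $[\mathcal{Q}]$ (different orientations give different variables); for an oriented matroid on $P$ with connected components $\mathcal{Q}_1,\dots,\mathcal{Q}_c$, $[\mathcal{Q}_1\oplus\cdots\oplus\mathcal{Q}_c]$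 denotes $[\mathcal{Q}_1]\cdots[\mathcal{Q}_c]$ (and $=1$ for empty ground set). With $\rho$ the rank function of $\mathcal{N}$, \[R(\mathcal{N}(P,E))=\sum_{A\subseteq E}[\mathcal{N}/A|P]\,g_A\,r_{E\setminus A}\,u^{\rho\mathcal{N}-\rho(\mathcal{N}/A|P)-\rho(A)}\,v^{|A|-\rho(A)}.\] -}

module Defs where

open import Level using (Level)
open import Data.Nat as ℕ using (ℕ; zero; suc; _∸_)
open import Data.Integer as ℤ using (ℤ; +_; -[1+_]; 0ℤ; 1ℤ; -1ℤ)
open import Data.Bool using (Bool; true; false; if_then_else_)
import Data.Bool as Bool
open import Data.Fin as Fin using (Fin; _↑ˡ_; _↑ʳ_; splitAt)
import Data.Fin.Properties as FinP
open import Data.Fin.Subset using (Subset; ⁅_⁆; _∪_; ∁; ∣_∣; _⊆_; ⊤; ⊥)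
open import Data.Fin.Subset.Properties using (_⊆?_)
open import Data.List as List using (List; []; _∷_; _++_; map; foldr; filter; length; allFin)
open import Data.List.Relation.Unary.Any using (any?)
open import Data.List.Relation.Unary.Unique.Propositional using (Unique)
import Data.List.Relation.Unary.Unique.DecPropositional as UDec
open import Data.Vec using ([]; _∷_)
open import Data.Vec.Properties using (≡-dec)
open import Data.Sum using (_⊎_; inj₁; inj₂)
open import Data.Product using (Σ; _×_; ∃; ∃-syntax; _,_)
open import Relation.Nullary using (¬_; Dec; yes; no; does; ¬?)
open import Relation.Nullary.Decidable using (_×-dec_)
open import Relation.Binary.PropositionalEquality using (_≡_; _≢_)
open import Algebra.Bundles using (CommutativeRing)
import Data.Rational.Properties as ℚP

-- Combinatorial preliminaries on the ground set Fin n.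
-- Subsets of Fin n are the Plücker indices; each subset is identified
-- with the sequence of its elements in increasing order.

allSubsets : ∀ n → List (Subset n)
allSubsets zero    = [] ∷ []
allSubsets (suc n) = map (true ∷_) (allSubsets n) ++ map (false ∷_) (allSubsets n)

lst : ∀ {n} → Subset n → List (Fin n)
lst []          = []
lst (true ∷ s)  = Fin.zero ∷ map Fin.suc (lst s)
lst (false ∷ s) = map Fin.suc (lst s)

setOf : ∀ {n} → List (Fin n) → Subset n
setOf = foldr (λ x s → ⁅ x ⁆ ∪ s) ⊥

_≟S_ : ∀ {n} (A B : Subset n) → Dec (A ≡ B)
_≟S_ = ≡-dec Bool._≟_

inversions : ∀ {n} → List (Fin n) → ℕ
inversions []       = 0
inversions (x ∷ xs) = length (filter (λ y → y Fin.<? x) xs) ℕ.+ inversions xs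

negOnePow : ℕ → ℤ
negOnePow zero    = 1ℤ
negOnePow (suc k) = ℤ.- negOnePow k

-- the sign of a sequence: 0 if it has a repeated element, otherwise the
-- sign of the permutation sorting it (so that  a₁∧…∧a_k = sgnSeq(a) · 𝐒 ,
-- S the underlying set in increasing order)
sgnSeq : ∀ {n} → List (Fin n) → ℤ
sgnSeq xs with UDec.unique? FinP._≟_ xs
... | yes _ = negOnePow (inversions xs)
... | no  _ = 0ℤ

sgnℤ : ℤ → ℤ
sgnℤ (+ zero)  = 0ℤ
sgnℤ (+ suc _) = 1ℤ
sgnℤ -[1+ _ ]  = -1ℤ

-- Exterior algebra ℰ(R S) over a commutative ring R, S = Fin n.
-- An element is given by its coordinates in the basis {𝐒 : S ⊆ Fin n},
-- 𝐒 the product of the elements of S in increasing order.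

module Ext {c ℓ : Level} (R : CommutativeRing c ℓ) where
  open CommutativeRing R

  Λ : ℕ → Set c
  Λ n = Subset n → Carrier

  natR : ℕ → Carrier
  natR zero    = 0#
  natR (suc k) = 1# + natR k

  fromℤ : ℤ → Carrier
  fromℤ (+ k)     = natR k
  fromℤ -[1+ k ]  = - natR (suc k)

  ΣL : ∀ {a} {A : Set a} → List A → (A → Carrier) → Carrier
  ΣL xs f = foldr (λ x s → f x + s) 0# xs

  ΠL : ∀ {a} {A : Set a} → List A → (A → Carrier) → Carrier
  ΠL xs f = foldr (λ x s → f x * s) 1# xs

  [_]? : ∀ {a} {P : Set a} → Dec P → Carrier
  [ d ]? = if does d then 1# else 0#

  -- Plücker coordinate of an arbitrary sequence (alternating extension)
  plk : ∀ {n} → Λ n → List (Fin n) → Carrier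
  plk x xs = fromℤ (sgnSeq xs) * x (setOf xs)

  𝟏 : ∀ {n} → Λ n
  𝟏 S = [ S ≟S ⊥ ]?

  _·_ : ∀ {n} → Carrier → Λ n → Λ n
  (a · x) S = a * x S

  _⊕_ : ∀ {n} → Λ n → Λ n → Λ n
  (x ⊕ y) S = x S + y S

  𝟎 : ∀ {n} → Λ n
  𝟎 S = 0#

  ΣΛ : ∀ {a} {A : Set a} {n} → List A → (A → Λ n) → Λ n
  ΣΛ xs f = foldr (λ x s → f x ⊕ s) 𝟎 xs

  -- exterior product:  x ∧ y = Σ_{A,B} x[A] y[B] 𝐀𝐁
  _∧_ : ∀ {n} → Λ n → Λ n → Λ n
  _∧_ {n} x y C =
    ΣL (allSubsets n) λ A → ΣL (allSubsets n) λ B →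
      [ (A ∪ B) ≟S C ]? * (fromℤ (sgnSeq (lst A ++ lst B)) * (x A * y B))

  vec : ∀ {n} → (Fin n → Carrier) → Λ n
  vec {n} v S = ΣL (allFin n) λ i → [ S ≟S ⁅ i ⁆ ]? * v i

  wedgeAll : ∀ {n} → List (Fin n → Carrier) → Λ n
  wedgeAll = foldr (λ v w → vec v ∧ w) 𝟏

  IsExtensor : ∀ {n} → Λ n → Set (c Level.⊔ ℓ)
  IsExtensor {n} x =
    (Σ Carrier λ a → ∀ S → x S ≈ (a · 𝟏) S)
    ⊎ (Σ (List (Fin n → Carrier)) λ vs → ∀ S → x S ≈ wedgeAll vs S)

  -- algebra homomorphism ℰ(R (Fin n)) → ℰ(R (Fin k)) induced by
  -- 𝐢 ↦ a i · 𝐟(i) on generators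
  relabel : ∀ {n k} → (Fin n → Fin k) → (Fin n → Carrier) → Λ n → Λ k
  relabel {n} f a x C =
    ΣL (allSubsets n) λ A →
      [ setOf (map f (lst A)) ≟S C ]?
        * (ΠL (lst A) a * (fromℤ (sgnSeq (map f (lst A))) * x A))

  -- contraction by a sequence es of elements of the bigger ground set;
  -- emb embeds the remaining ground set:  (x/es)[B] = x[B es]
  contract : ∀ {n k} → (Fin k → Fin n) → List (Fin n) → Λ n → Λ k
  contract emb es x B = plk x (map emb (lst B) ++ es)

  dual : ∀ {n} → (List (Fin n) → ℤ) → Λ n → Λ n
  dual ε x X = plk x (lst (∁ X)) * fromℤ (ε (lst (∁ X) ++ lst X))

open Ext ℚP.+-*-commutativeRing using () renaming (IsExtensor to IsExtensorℚ; fromℤ to ℤ→ℚ)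

-- An integer Plücker vector is an extensor (over the field ℚ ⊆ K)
IsExtensorℤ : ∀ {n} → (Subset n → ℤ) → Set
IsExtensorℤ x = IsExtensorℚ (λ S → ℤ→ℚ (x S))

Unimodular : ∀ {n} → (Subset n → ℤ) → Set
Unimodular x = ∀ S → (x S ≡ 0ℤ) ⊎ (x S ≡ 1ℤ) ⊎ (x S ≡ -1ℤ)

NonZero : ∀ {n} → (Subset n → ℤ) → Set
NonZero {n} x = ∃[ S ] (x S ≢ 0ℤ)

UnimodularExtensor : ∀ {n} → (Subset n → ℤ) → Set
UnimodularExtensor x = IsExtensorℤ x × Unimodular x × NonZero x

plkℤ : ∀ {n} → (Subset n → ℤ) → List (Fin n) → ℤ
plkℤ x xs = sgnSeq xs ℤ.* x (setOf xs)

GroundSetOrientation : ∀ {n} → (List (Fin n) → ℤ) → Set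
GroundSetOrientation {n} ε =
    (∀ xs → (ε xs ≡ 1ℤ) ⊎ (ε xs ≡ -1ℤ) ⊎ (ε xs ≡ 0ℤ))
  × (∀ (xs ys : List (Fin n)) a b → ε (xs ++ a ∷ b ∷ ys) ≡ ℤ.- ε (xs ++ b ∷ a ∷ ys))
  × (∀ xs → Unique xs → ε xs ≢ 0ℤ)
  × (ε [] ≡ 1ℤ)

isIndep : ∀ {n} (x : Subset n → ℤ) (I : Subset n) → Bool
isIndep {n} x I = does (any? (λ B → (I ⊆? B) ×-dec ¬? (x B ℤ.≟ 0ℤ)) (allSubsets n))

rank : ∀ {n} (x : Subset n → ℤ) (X : Subset n) → ℕ
rank {n} x X =
  foldr (λ I m → if does (I ⊆? X) Bool.∧ isIndep x I then ∣ I ∣ ℕ.⊔ m else m) 0 (allSubsets n)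

-- Ported setting: ground set of 𝐍 is P ⊔ E with P = Fin p, E = Fin m,
-- realised as Fin (p ℕ.+ m) (P first).  The ground set of 𝐌(𝐍) is
-- P_ι ⊔ P_υ ⊔ E realised as Fin ((p ℕ.+ p) ℕ.+ m).

module Ported (p m : ℕ) where

  ιP : Fin p → Fin (p ℕ.+ m)
  ιP i = i ↑ˡ m
  ιE : Fin m → Fin (p ℕ.+ m)
  ιE e = p ↑ʳ e

  Pseq : List (Fin (p ℕ.+ m))
  Pseq = map ιP (allFin p)
  Eseq : List (Fin (p ℕ.+ m))
  Eseq = map ιE (allFin m)

  Pset : Subset (p ℕ.+ m)
  Pset = setOf Pseq

  Eimg : Subset m → Subset (p ℕ.+ m)
  Eimg A = setOf (map ιE (lst A))

  εP : (List (Fin (p ℕ.+ m)) → ℤ) → List (Fin p) → ℤ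
  εP ε xs = ε (map ιP xs)

  minorRank : (Subset (p ℕ.+ m) → ℤ) → Subset m → ℕ
  minorRank N A = rank N (Eimg A ∪ Pset) ∸ rank N (Eimg A)

  -- Chirotope of 𝒩/A|P: B ↦ χ(B J I), where I is a basis of A and
  -- J ⊆ E∖A is a basis of 𝒩/(A ∪ P) (so B J I is a basis of 𝒩 exactly
  -- when B is a basis of the minor); presentation is up to a global sign.
  PresentsMinor : (N : Subset (p ℕ.+ m) → ℤ) (A : Subset m) (L : Subset p → ℤ) → Set
  PresentsMinor N A L =
    Σ (Subset (p ℕ.+ m)) λ I → Σ (Subset (p ℕ.+ m)) λ J → Σ ℤ λ σ →
        (I ⊆ Eimg A) × (rank N I ≡ ∣ I ∣) × (rank N I ≡ rank N (Eimg A))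
      × (J ⊆ Eimg (∁ A)) × (rank N (J ∪ (Eimg A ∪ Pset)) ≡ rank N ⊤)
      × (∣ J ∣ ℕ.+ rank N (Eimg A ∪ Pset) ≡ rank N ⊤)
      × ((σ ≡ 1ℤ) ⊎ (σ ≡ -1ℤ))
      × (∀ B → sgnℤ (L B) ≡ σ ℤ.* sgnℤ (plkℤ N (map ιP (lst B) ++ lst J ++ lst I)))

  module OverRing {c ℓ : Level} (R : CommutativeRing c ℓ) where
    open CommutativeRing R
    open Ext R

    Pι Pυ : Fin p → Fin ((p ℕ.+ p) ℕ.+ m)
    Pι i = (i ↑ˡ p) ↑ˡ m
    Pυ i = (p ↑ʳ i) ↑ˡ m
    Em : Fin m → Fin ((p ℕ.+ p) ℕ.+ m)
    Em e = (p ℕ.+ p) ↑ʳ e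

    ιmap υmap : Fin (p ℕ.+ m) → Fin ((p ℕ.+ p) ℕ.+ m)
    ιmap x with splitAt p x
    ... | inj₁ i = Pι i
    ... | inj₂ e = Em e
    υmap x with splitAt p x
    ... | inj₁ i = Pυ i
    ... | inj₂ e = Em e

    scal : (Fin m → Carrier) → Fin (p ℕ.+ m) → Carrier
    scal g x with splitAt p x
    ... | inj₁ _ = 1#
    ... | inj₂ e = g e

    ι_ : (Fin m → Carrier) → Λ (p ℕ.+ m) → Λ ((p ℕ.+ p) ℕ.+ m)
    ι_ g = relabel ιmap (scal g)
    υ_ : (Fin m → Carrier) → Λ (p ℕ.+ m) → Λ ((p ℕ.+ p) ℕ.+ m)
    υ_ r = relabel υmap (scal r)

    toR : ∀ {n} → (Subset n → ℤ) → Λ n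
    toR x S = fromℤ (x S)

    𝐌 : (List (Fin (p ℕ.+ m)) → ℤ) → (g r : Fin m → Carrier) → (Subset (p ℕ.+ m) → ℤ) → Λ ((p ℕ.+ p) ℕ.+ m)
    𝐌 ε g r N = (ι_ g) (toR N) ∧ (υ_ r) (dual ε (toR N))

    𝐌E : (List (Fin (p ℕ.+ m)) → ℤ) → (g r : Fin m → Carrier) → (Subset (p ℕ.+ m) → ℤ) → Λ (p ℕ.+ p)
    𝐌E ε g r N = contract (λ i → i ↑ˡ m) (map Em (allFin m)) (𝐌 ε g r N)

    𝐌∅P : (List (Fin p) → ℤ) → (Subset p → ℤ) → Λ (p ℕ.+ p)
    𝐌∅P εp L = contract (λ i → i) []
      (relabel (λ i → i ↑ˡ p) (λ _ → 1#) (toR L) ∧ relabel (λ i → p ↑ʳ i) (λ _ → 1#) (dual εp (toR L)))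

    -- u^k evaluated at u = 0
    _^_ : Carrier → ℕ → Carrier
    a ^ zero  = 1#
    a ^ suc k = a * (a ^ k)

    Rsubst : (ε : List (Fin (p ℕ.+ m)) → ℤ) (g r : Fin m → Carrier)
             (N : Subset (p ℕ.+ m) → ℤ) (L : Subset m → Subset p → ℤ) → Λ (p ℕ.+ p)
    Rsubst ε g r N L = ΣΛ (allSubsets m) λ A →
      ((ΠL (lst A) g * ΠL (lst (∁ A)) r)
         * ((0# ^ ((rank N ⊤ ∸ minorRank N A) ∸ rank N (Eimg A)))
            * (0# ^ (∣ A ∣ ∸ rank N (Eimg A)))))
      · ((fromℤ (ε Pseq) * fromℤ (ε (Pseq ++ Eseq))) · 𝐌∅P (εP ε) (L A))

-- Expanding 𝐌(𝐍) = ι_g(𝐍) ∧ υ_r(𝐍^⊥) and contracting by E, the coordinate of 𝐌_E(𝐍) at X_ι Y_υ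
-- (X, Y ⊆ P) is a sum over S ⊆ E, since the E-parts of the two factors must be S and E ∖ S; its
-- S-th summand is g_S r_{E∖S} 𝐍[X S] 𝐍[(P∖Y) S] times a sign.  This summand vanishes unless X ∪ S
-- is a basis, and then, all bases of an extensor having the same size, S is independent and S ∪ P
-- spans: both exponents of u and v vanish.  Conversely, when they vanish, the presentation of
-- 𝒩/S|P is 𝐋_S[B] = σ 𝐍[B S] with σ = ±1, so that 𝐌_∅(𝐋_S)[X Y] = 𝐍[X S] 𝐍[(P∖Y) S] ε((P∖Y) Y).
-- What is left is an identity between signs, proved by sorting the sequences involved, using
-- that both ε and the sorting sign are alternating.
module Submission where

open import Defs
open import Level using (Level)
open import Function using (_∘_; id)
open import Data.Nat as ℕ using (ℕ; zero; suc; _≤_; _∸_)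
import Data.Nat.Properties as ℕP
open import Data.Integer as ℤ using (ℤ; 0ℤ; 1ℤ; -1ℤ)
import Data.Integer.Properties as ℤP
open import Data.Rational as ℚ using (0ℚ; 1ℚ)
import Data.Rational.Properties as ℚP
open import Data.Bool as Bool using (true; false; not; if_then_else_)
open import Data.Fin as Fin using (Fin; _↑ˡ_; _↑ʳ_)
import Data.Fin.Properties as FinP
open import Data.Fin.Subset as Subset using (Subset; _∪_; _⊆_; ∁; ∣_∣; ⁅_⁆; ⊤; ⊥)
open import Data.Fin.Subset.Properties as SubsetP using (_⊆?_)
open import Data.Vec as Vec using (Vec; []; _∷_; take; drop) renaming (_++_ to _++ᵛ_)
import Data.Vec.Properties as VecP
open import Data.List as List using (List; []; _∷_; _++_; map; filter; length; foldr; allFin)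
import Data.List.Properties as ListP
open import Data.List.Relation.Unary.All as All using (All; []; _∷_)
import Data.List.Relation.Unary.All.Properties as AllP
open import Data.List.Relation.Unary.AllPairs using ([]; _∷_)
open import Data.List.Relation.Unary.Any as Any using (here; there; any?)
open import Data.List.Relation.Unary.Unique.Propositional using (Unique)
import Data.List.Relation.Unary.Unique.Propositional.Properties as UniqueP
import Data.List.Relation.Unary.Unique.DecPropositional as UniqueDec
open import Data.List.Membership.Propositional using (_∈_; lose)
import Data.List.Membership.Propositional.Properties as ∈P
open import Data.List.Relation.Binary.Permutation.Propositional as Perm using (_↭_; ↭-trans; ↭-reflexive)
import Data.List.Relation.Binary.Permutation.Propositional.Properties as PermP
open import Data.Sum using (_⊎_; inj₁; inj₂)
open import Data.Product using (Σ; ∃; _×_; _,_; proj₁; proj₂)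
open import Relation.Nullary using (¬_; Dec; yes; no; does; ¬?)
open import Relation.Nullary.Decidable using (dec-true; decidable-stable; _×-dec_)
open import Relation.Nullary.Negation using (contradiction)
open import Relation.Binary.Definitions using (tri<; tri≈; tri>)
open import Relation.Binary.PropositionalEquality as ≡ using (_≡_; _≢_; cong; cong₂; subst; subst₂)
open import Algebra.Bundles using (CommutativeRing)
import Algebra.Properties.CommutativeSemigroup as CommutativeSemigroupProperties

private
  module ℕ+ = CommutativeSemigroupProperties ℕP.+-commutativeSemigroup
  module ℤ* = CommutativeSemigroupProperties ℤP.*-commutativeSemigroup

-- Signs of sequences and alternating functions

IsSign : ℤ → Set
IsSign z = z ≡ 1ℤ ⊎ z ≡ -1ℤ

sign-square : ∀ {z} → IsSign z → z ℤ.* z ≡ 1ℤ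
sign-square (inj₁ ≡.refl) = ≡.refl
sign-square (inj₂ ≡.refl) = ≡.refl

negOnePow-sign : ∀ k → IsSign (negOnePow k)
negOnePow-sign zero = inj₁ ≡.refl
negOnePow-sign (suc k) with negOnePow k | negOnePow-sign k
... | _ | inj₁ ≡.refl = inj₂ ≡.refl
... | _ | inj₂ ≡.refl = inj₁ ≡.refl

negOnePow-+ : ∀ a b → negOnePow (a ℕ.+ b) ≡ negOnePow a ℤ.* negOnePow b
negOnePow-+ zero    b = ≡.sym (ℤP.*-identityˡ _)
negOnePow-+ (suc a) b =
  ≡.trans (cong ℤ.-_ (negOnePow-+ a b)) (ℤP.neg-distribˡ-* (negOnePow a) (negOnePow b))

neg-*-neg : ∀ i j → ℤ.- i ℤ.* ℤ.- j ≡ i ℤ.* j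
neg-*-neg i j = begin
  ℤ.- i ℤ.* ℤ.- j       ≡⟨ ℤP.neg-distribˡ-* i (ℤ.- j) ⟨
  ℤ.- (i ℤ.* ℤ.- j)     ≡⟨ cong ℤ.-_ (ℤP.neg-distribʳ-* i j) ⟨
  ℤ.- ℤ.- (i ℤ.* j)     ≡⟨ ℤP.neg-involutive _ ⟩
  i ℤ.* j               ∎
  where open ≡.≡-Reasoning

Alternating : ∀ {a} {A : Set a} → (List A → ℤ) → Set a
Alternating F = ∀ xs ys a b → F (xs ++ a ∷ b ∷ ys) ≡ ℤ.- F (xs ++ b ∷ a ∷ ys)

nonunique-++-∈ : ∀ {a} {A : Set a} {xs ys : List A} {x} → x ∈ xs → x ∈ ys → ¬ Unique (xs ++ ys)
nonunique-++-∈ {xs = x ∷ xs} (here ≡.refl) x∈ys (x∉ ∷ _) = All.lookup (AllP.++⁻ʳ xs x∉) x∈ys ≡.refl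
nonunique-++-∈ {xs = _ ∷ xs} (there x∈xs)  x∈ys (_ ∷ u)  = nonunique-++-∈ x∈xs x∈ys u

module _ {n : ℕ} where

  open ≡.≡-Reasoning

  sgnSeq-unique : {xs : List (Fin n)} → Unique xs → sgnSeq xs ≡ negOnePow (inversions xs)
  sgnSeq-unique {xs} u with UniqueDec.unique? FinP._≟_ xs
  ... | yes _ = ≡.refl
  ... | no ¬u = contradiction u ¬u

  sgnSeq-nonunique : {xs : List (Fin n)} → ¬ Unique xs → sgnSeq xs ≡ 0ℤ
  sgnSeq-nonunique {xs} ¬u with UniqueDec.unique? FinP._≟_ xs
  ... | yes u = contradiction u ¬u
  ... | no _  = ≡.refl

  below : Fin n → List (Fin n) → ℕ
  below x ys = length (filter (Fin._<? x) ys)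

  below-↭ : ∀ x {ys zs} → ys ↭ zs → below x ys ≡ below x zs
  below-↭ x ys↭zs = PermP.↭-length (PermP.filter-↭ (Fin._<? x) ys↭zs)

  swap-↭ : ∀ pre {a b : Fin n} post → pre ++ a ∷ b ∷ post ↭ pre ++ b ∷ a ∷ post
  swap-↭ pre _ = PermP.++⁺ˡ pre (Perm.swap _ _ Perm.refl)

  inversions-swap : ∀ pre {a b} post → b Fin.< a →
                    inversions (pre ++ a ∷ b ∷ post) ≡ suc (inversions (pre ++ b ∷ a ∷ post))
  inversions-swap [] {a} {b} post b<a
    rewrite ListP.filter-accept (Fin._<? a) {b} {post} b<a
          | ListP.filter-reject (Fin._<? b) {a} {post} (FinP.<-asym b<a)
    = cong suc (ℕ+.x∙yz≈y∙xz (below a post) (below b post) (inversions post))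
  inversions-swap (z ∷ pre) post b<a =
    ≡.trans (cong₂ ℕ._+_ (below-↭ z (swap-↭ pre post)) (inversions-swap pre post b<a))
            (ℕP.+-suc _ _)

  unique-swap : ∀ pre {a b : Fin n} post → Unique (pre ++ a ∷ b ∷ post) → Unique (pre ++ b ∷ a ∷ post)
  unique-swap []        post ((a≢b ∷ a∉) ∷ b∉ ∷ u) = ((a≢b ∘ ≡.sym) ∷ b∉) ∷ a∉ ∷ u
  unique-swap (x ∷ pre) post (x∉ ∷ u) =
    PermP.All-resp-↭ (swap-↭ pre post) x∉ ∷ unique-swap pre post u

  nonunique-repeat : ∀ pre {a : Fin n} post → ¬ Unique (pre ++ a ∷ a ∷ post)
  nonunique-repeat []        post ((a≢a ∷ _) ∷ _) = a≢a ≡.refl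
  nonunique-repeat (x ∷ pre) post (_ ∷ u)         = nonunique-repeat pre post u

  private
    sgnSeq-swap-> : ∀ pre {a b : Fin n} post → b Fin.< a →
                    sgnSeq (pre ++ a ∷ b ∷ post) ≡ ℤ.- sgnSeq (pre ++ b ∷ a ∷ post)
    sgnSeq-swap-> pre {a} {b} post b<a = by-uniqueness (UniqueDec.unique? FinP._≟_ (pre ++ b ∷ a ∷ post))
      where
      by-uniqueness : Dec (Unique (pre ++ b ∷ a ∷ post)) →
                      sgnSeq (pre ++ a ∷ b ∷ post) ≡ ℤ.- sgnSeq (pre ++ b ∷ a ∷ post)
      by-uniqueness (yes u) = begin
        sgnSeq (pre ++ a ∷ b ∷ post)                     ≡⟨ sgnSeq-unique (unique-swap pre post u) ⟩
        negOnePow (inversions (pre ++ a ∷ b ∷ post))     ≡⟨ cong negOnePow (inversions-swap pre post b<a) ⟩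
        ℤ.- negOnePow (inversions (pre ++ b ∷ a ∷ post)) ≡⟨ cong ℤ.-_ (sgnSeq-unique u) ⟨
        ℤ.- sgnSeq (pre ++ b ∷ a ∷ post)                 ∎
      by-uniqueness (no ¬u) = begin
        sgnSeq (pre ++ a ∷ b ∷ post)     ≡⟨ sgnSeq-nonunique (¬u ∘ unique-swap pre post) ⟩
        0ℤ                               ≡⟨ cong ℤ.-_ (sgnSeq-nonunique ¬u) ⟨
        ℤ.- sgnSeq (pre ++ b ∷ a ∷ post) ∎

  sgnSeq-alternating : Alternating (sgnSeq {n})
  sgnSeq-alternating pre post a b with FinP.<-cmp a b
  ... | tri> _ _ b<a = sgnSeq-swap-> pre post b<a
  ... | tri< a<b _ _ = begin
    sgnSeq (pre ++ a ∷ b ∷ post)         ≡⟨ ℤP.neg-involutive _ ⟨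
    ℤ.- ℤ.- sgnSeq (pre ++ a ∷ b ∷ post) ≡⟨ cong ℤ.-_ (sgnSeq-swap-> pre post a<b) ⟨
    ℤ.- sgnSeq (pre ++ b ∷ a ∷ post)     ∎
  ... | tri≈ _ ≡.refl _ = begin
    sgnSeq (pre ++ a ∷ a ∷ post)     ≡⟨ sgnSeq-nonunique (nonunique-repeat pre post) ⟩
    0ℤ                               ≡⟨ cong ℤ.-_ (sgnSeq-nonunique (nonunique-repeat pre post)) ⟨
    ℤ.- sgnSeq (pre ++ a ∷ a ∷ post) ∎

  _≺_ : List (Fin n) → List (Fin n) → Set
  xs ≺ ys = All (λ x → All (x Fin.<_) ys) xs

  inversions-++-≺ : ∀ xs ys → xs ≺ ys → inversions (xs ++ ys) ≡ inversions xs ℕ.+ inversions ys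
  inversions-++-≺ []       ys _ = ≡.refl
  inversions-++-≺ (x ∷ xs) ys (x<ys ∷ xs≺ys) = begin
    below x (xs ++ ys) ℕ.+ inversions (xs ++ ys)
      ≡⟨ cong₂ ℕ._+_ below-++ (inversions-++-≺ xs ys xs≺ys) ⟩
    below x xs ℕ.+ (inversions xs ℕ.+ inversions ys)
      ≡⟨ ℕP.+-assoc (below x xs) _ _ ⟨
    below x xs ℕ.+ inversions xs ℕ.+ inversions ys ∎
    where
    below-++ : below x (xs ++ ys) ≡ below x xs
    below-++ = begin
      length (filter (Fin._<? x) (xs ++ ys))
        ≡⟨ cong length (ListP.filter-++ (Fin._<? x) xs ys) ⟩
      length (filter (Fin._<? x) xs ++ filter (Fin._<? x) ys)
        ≡⟨ cong (λ zs → length (filter (Fin._<? x) xs ++ zs))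
                (ListP.filter-none (Fin._<? x) (All.map FinP.<-asym x<ys)) ⟩
      length (filter (Fin._<? x) xs ++ [])
        ≡⟨ cong length (ListP.++-identityʳ (filter (Fin._<? x) xs)) ⟩
      below x xs ∎

  unique-++⁻ : ∀ (xs ys : List (Fin n)) → Unique (xs ++ ys) → Unique xs × Unique ys
  unique-++⁻ []       ys u = [] , u
  unique-++⁻ (x ∷ xs) ys (x∉ ∷ u) with unique-++⁻ xs ys u
  ... | uxs , uys = AllP.++⁻ˡ xs x∉ ∷ uxs , uys

  sgnSeq-++-≺ : ∀ xs ys → xs ≺ ys → sgnSeq (xs ++ ys) ≡ sgnSeq xs ℤ.* sgnSeq ys
  sgnSeq-++-≺ xs ys xs≺ys = by-uniqueness (UniqueDec.unique? FinP._≟_ xs) (UniqueDec.unique? FinP._≟_ ys)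
    where
    disjoint : ∀ {v} → ¬ (v ∈ xs × v ∈ ys)
    disjoint (v∈xs , v∈ys) = FinP.<-irrefl ≡.refl (All.lookup (All.lookup xs≺ys v∈xs) v∈ys)

    by-uniqueness : Dec (Unique xs) → Dec (Unique ys) → sgnSeq (xs ++ ys) ≡ sgnSeq xs ℤ.* sgnSeq ys
    by-uniqueness (yes uxs) (yes uys) = begin
      sgnSeq (xs ++ ys)                                       ≡⟨ sgnSeq-unique (UniqueP.++⁺ uxs uys disjoint) ⟩
      negOnePow (inversions (xs ++ ys))                       ≡⟨ cong negOnePow (inversions-++-≺ xs ys xs≺ys) ⟩
      negOnePow (inversions xs ℕ.+ inversions ys)             ≡⟨ negOnePow-+ (inversions xs) (inversions ys) ⟩
      negOnePow (inversions xs) ℤ.* negOnePow (inversions ys) ≡⟨ cong₂ ℤ._*_ (sgnSeq-unique uxs) (sgnSeq-unique uys) ⟨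
      sgnSeq xs ℤ.* sgnSeq ys                                 ∎
    by-uniqueness (no ¬uxs) _ = begin
      sgnSeq (xs ++ ys)       ≡⟨ sgnSeq-nonunique (¬uxs ∘ proj₁ ∘ unique-++⁻ xs ys) ⟩
      0ℤ                      ≡⟨ cong (ℤ._* sgnSeq ys) (sgnSeq-nonunique ¬uxs) ⟨
      sgnSeq xs ℤ.* sgnSeq ys ∎
    by-uniqueness (yes _) (no ¬uys) = begin
      sgnSeq (xs ++ ys)       ≡⟨ sgnSeq-nonunique (¬uys ∘ proj₂ ∘ unique-++⁻ xs ys) ⟩
      0ℤ                      ≡⟨ ℤP.*-zeroʳ (sgnSeq xs) ⟨
      sgnSeq xs ℤ.* 0ℤ        ≡⟨ cong (sgnSeq xs ℤ.*_) (sgnSeq-nonunique ¬uys) ⟨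
      sgnSeq xs ℤ.* sgnSeq ys ∎

module _ {n k : ℕ} {f : Fin n → Fin k} (f-mono : ∀ {i j} → i Fin.< j → f i Fin.< f j) where

  open ≡.≡-Reasoning

  private
    f-reflects-< : ∀ {i j} → f i Fin.< f j → i Fin.< j
    f-reflects-< {i} {j} fi<fj with FinP.<-cmp i j
    ... | tri< i<j _ _ = i<j
    ... | tri≈ _ ≡.refl _ = contradiction fi<fj (FinP.<-irrefl ≡.refl)
    ... | tri> _ _ j<i = contradiction (f-mono j<i) (FinP.<-asym fi<fj)

    f-injective : ∀ {i j} → f i ≡ f j → i ≡ j
    f-injective {i} {j} fi≡fj with FinP.<-cmp i j
    ... | tri< i<j _ _ = contradiction fi≡fj (FinP.<⇒≢ (f-mono i<j))
    ... | tri≈ _ i≡j _ = i≡j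
    ... | tri> _ _ j<i = contradiction (≡.sym fi≡fj) (FinP.<⇒≢ (f-mono j<i))

  below-map : ∀ x ys → below (f x) (map f ys) ≡ below x ys
  below-map x [] = ≡.refl
  below-map x (y ∷ ys) with y Fin.<? x
  ... | yes y<x rewrite ListP.filter-accept (Fin._<? f x) {f y} {map f ys} (f-mono y<x)
                      | ListP.filter-accept (Fin._<? x) {y} {ys} y<x = cong suc (below-map x ys)
  ... | no y≮x rewrite ListP.filter-reject (Fin._<? f x) {f y} {map f ys} (y≮x ∘ f-reflects-<)
                     | ListP.filter-reject (Fin._<? x) {y} {ys} y≮x = below-map x ys

  inversions-map : ∀ xs → inversions (map f xs) ≡ inversions xs
  inversions-map []       = ≡.refl
  inversions-map (x ∷ xs) = cong₂ ℕ._+_ (below-map x xs) (inversions-map xs)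

  sgnSeq-map : ∀ xs → sgnSeq (map f xs) ≡ sgnSeq xs
  sgnSeq-map xs = by-uniqueness (UniqueDec.unique? FinP._≟_ xs)
    where
    by-uniqueness : Dec (Unique xs) → sgnSeq (map f xs) ≡ sgnSeq xs
    by-uniqueness (yes u) = begin
      sgnSeq (map f xs)                  ≡⟨ sgnSeq-unique (UniqueP.map⁺ f-injective u) ⟩
      negOnePow (inversions (map f xs))  ≡⟨ cong negOnePow (inversions-map xs) ⟩
      negOnePow (inversions xs)          ≡⟨ sgnSeq-unique u ⟨
      sgnSeq xs                          ∎
    by-uniqueness (no ¬u) = begin
      sgnSeq (map f xs) ≡⟨ sgnSeq-nonunique (¬u ∘ UniqueP.map⁻) ⟩
      0ℤ                ≡⟨ sgnSeq-nonunique ¬u ⟨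
      sgnSeq xs         ∎

↑ˡ-mono : ∀ {a} b {i j : Fin a} → i Fin.< j → i ↑ˡ b Fin.< j ↑ˡ b
↑ˡ-mono b {i} {j} = subst₂ ℕ._<_ (≡.sym (FinP.toℕ-↑ˡ i b)) (≡.sym (FinP.toℕ-↑ˡ j b))

↑ʳ-mono : ∀ a {b} {i j : Fin b} → i Fin.< j → a ↑ʳ i Fin.< a ↑ʳ j
↑ʳ-mono a {_} {i} {j} = subst₂ ℕ._<_ (≡.sym (FinP.toℕ-↑ʳ a i)) (≡.sym (FinP.toℕ-↑ʳ a j)) ∘ ℕP.+-monoʳ-< a

sgnSeq-↑ : ∀ {a b} (xs : List (Fin a)) (ys : List (Fin b)) →
           sgnSeq (map (_↑ˡ b) xs ++ map (a ↑ʳ_) ys) ≡ sgnSeq xs ℤ.* sgnSeq ys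
sgnSeq-↑ {a} {b} xs ys = begin
  sgnSeq (map (_↑ˡ b) xs ++ map (a ↑ʳ_) ys)
    ≡⟨ sgnSeq-++-≺ (map (_↑ˡ b) xs) (map (a ↑ʳ_) ys) separated ⟩
  sgnSeq (map (_↑ˡ b) xs) ℤ.* sgnSeq (map (a ↑ʳ_) ys)
    ≡⟨ cong₂ ℤ._*_ (sgnSeq-map (↑ˡ-mono b) xs) (sgnSeq-map (↑ʳ-mono a) ys) ⟩
  sgnSeq xs ℤ.* sgnSeq ys ∎
  where
  open ≡.≡-Reasoning
  separated : map (_↑ˡ b) xs ≺ map (a ↑ʳ_) ys
  separated = AllP.map⁺ (All.universal (λ i → AllP.map⁺ (All.universal (λ j → lt i j) ys)) xs)
    where
    lt : ∀ i j → i ↑ˡ b Fin.< a ↑ʳ j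
    lt i j = subst₂ ℕ._<_ (≡.sym (FinP.toℕ-↑ˡ i b)) (≡.sym (FinP.toℕ-↑ʳ a j))
                    (ℕP.<-≤-trans (FinP.toℕ<n i) (ℕP.m≤m+n a _))

-- lst (b ∷ S) is definitionally of the shape treated by sgnSeq-↑ with a = 1.
sgnSeq-lst : ∀ {n} (S : Subset n) → sgnSeq (lst S) ≡ 1ℤ
sgnSeq-lst []          = ≡.refl
sgnSeq-lst (true ∷ S)  =
  ≡.trans (sgnSeq-↑ (Fin.zero ∷ []) (lst S)) (≡.trans (ℤP.*-identityˡ _) (sgnSeq-lst S))
sgnSeq-lst (false ∷ S) =
  ≡.trans (sgnSeq-↑ {1} [] (lst S)) (≡.trans (ℤP.*-identityˡ _) (sgnSeq-lst S))

module _ {a} {A : Set a} (F : List A → ℤ) (F-alt : Alternating F) where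

  open ≡.≡-Reasoning

  private
    snoc : ∀ pre (x : A) xs → pre ++ x ∷ xs ≡ (pre ++ x ∷ []) ++ xs
    snoc pre x xs = ≡.sym (ListP.++-assoc pre (x ∷ []) xs)

  alternating-move : ∀ pre bs c post →
                     F (pre ++ bs ++ c ∷ post) ≡ negOnePow (length bs) ℤ.* F (pre ++ c ∷ bs ++ post)
  alternating-move pre []       c post = ≡.sym (ℤP.*-identityˡ _)
  alternating-move pre (b ∷ bs) c post = begin
    F (pre ++ b ∷ bs ++ c ∷ post)
      ≡⟨ cong F (snoc pre b _) ⟩
    F ((pre ++ b ∷ []) ++ bs ++ c ∷ post)
      ≡⟨ alternating-move (pre ++ b ∷ []) bs c post ⟩
    ν ℤ.* F ((pre ++ b ∷ []) ++ c ∷ bs ++ post)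
      ≡⟨ cong (λ zs → ν ℤ.* F zs) (snoc pre b _) ⟨
    ν ℤ.* F (pre ++ b ∷ c ∷ bs ++ post)
      ≡⟨ cong (ν ℤ.*_) (F-alt pre (bs ++ post) b c) ⟩
    ν ℤ.* ℤ.- F (pre ++ c ∷ b ∷ bs ++ post)
      ≡⟨ ℤP.neg-distribʳ-* ν _ ⟨
    ℤ.- (ν ℤ.* F (pre ++ c ∷ b ∷ bs ++ post))
      ≡⟨ ℤP.neg-distribˡ-* ν _ ⟩
    negOnePow (suc (length bs)) ℤ.* F (pre ++ c ∷ b ∷ bs ++ post) ∎
    where ν = negOnePow (length bs)

  alternating-swap-blocks : ∀ pre bs cs post →
    F (pre ++ bs ++ cs ++ post) ≡ negOnePow (length cs ℕ.* length bs) ℤ.* F (pre ++ cs ++ bs ++ post)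
  alternating-swap-blocks pre bs []       post = ≡.sym (ℤP.*-identityˡ _)
  alternating-swap-blocks pre bs (c ∷ cs) post = begin
    F (pre ++ bs ++ c ∷ cs ++ post)
      ≡⟨ alternating-move pre bs c (cs ++ post) ⟩
    ν ℤ.* F (pre ++ c ∷ bs ++ cs ++ post)
      ≡⟨ cong (λ zs → ν ℤ.* F zs) (snoc pre c _) ⟩
    ν ℤ.* F ((pre ++ c ∷ []) ++ bs ++ cs ++ post)
      ≡⟨ cong (ν ℤ.*_) (alternating-swap-blocks (pre ++ c ∷ []) bs cs post) ⟩
    ν ℤ.* (ν′ ℤ.* F ((pre ++ c ∷ []) ++ cs ++ bs ++ post))
      ≡⟨ cong (λ zs → ν ℤ.* (ν′ ℤ.* F zs)) (snoc pre c _) ⟨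
    ν ℤ.* (ν′ ℤ.* F (pre ++ c ∷ cs ++ bs ++ post))
      ≡⟨ ℤP.*-assoc ν ν′ _ ⟨
    (ν ℤ.* ν′) ℤ.* F (pre ++ c ∷ cs ++ bs ++ post)
      ≡⟨ cong (ℤ._* F (pre ++ c ∷ cs ++ bs ++ post)) (negOnePow-+ (length bs) _) ⟨
    negOnePow (length (c ∷ cs) ℕ.* length bs) ℤ.* F (pre ++ c ∷ cs ++ bs ++ post) ∎
    where
    ν  = negOnePow (length bs)
    ν′ = negOnePow (length cs ℕ.* length bs)

  alternating-interchange : ∀ as bs cs ds →
    F ((as ++ bs) ++ (cs ++ ds)) ≡ negOnePow (length cs ℕ.* length bs) ℤ.* F ((as ++ cs) ++ (bs ++ ds))
  alternating-interchange as bs cs ds = begin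
    F ((as ++ bs) ++ (cs ++ ds))
      ≡⟨ cong F (ListP.++-assoc as bs _) ⟩
    F (as ++ bs ++ cs ++ ds)
      ≡⟨ alternating-swap-blocks as bs cs ds ⟩
    negOnePow (length cs ℕ.* length bs) ℤ.* F (as ++ cs ++ bs ++ ds)
      ≡⟨ cong (λ zs → negOnePow (length cs ℕ.* length bs) ℤ.* F zs) (ListP.++-assoc as cs _) ⟨
    negOnePow (length cs ℕ.* length bs) ℤ.* F ((as ++ cs) ++ (bs ++ ds)) ∎

  alternating-context : ∀ {b} {B : Set b} pre (f : B → A) post →
                        Alternating (λ zs → F (pre ++ map f zs ++ post))
  alternating-context pre f post xs ys x y = begin
    F (pre ++ map f (xs ++ x ∷ y ∷ ys) ++ post)
      ≡⟨ cong F (splice x y) ⟩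
    F ((pre ++ map f xs) ++ f x ∷ f y ∷ map f ys ++ post)
      ≡⟨ F-alt (pre ++ map f xs) (map f ys ++ post) (f x) (f y) ⟩
    ℤ.- F ((pre ++ map f xs) ++ f y ∷ f x ∷ map f ys ++ post)
      ≡⟨ cong (ℤ.-_ ∘ F) (splice y x) ⟨
    ℤ.- F (pre ++ map f (xs ++ y ∷ x ∷ ys) ++ post) ∎
    where
    splice : ∀ u v → pre ++ map f (xs ++ u ∷ v ∷ ys) ++ post ≡ (pre ++ map f xs) ++ f u ∷ f v ∷ map f ys ++ post
    splice u v = begin
      pre ++ map f (xs ++ u ∷ v ∷ ys) ++ post
        ≡⟨ cong (λ zs → pre ++ zs ++ post) (ListP.map-++ f xs (u ∷ v ∷ ys)) ⟩
      pre ++ (map f xs ++ f u ∷ f v ∷ map f ys) ++ post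
        ≡⟨ cong (pre ++_) (ListP.++-assoc (map f xs) _ post) ⟩
      pre ++ map f xs ++ f u ∷ f v ∷ map f ys ++ post
        ≡⟨ ListP.++-assoc pre (map f xs) _ ⟨
      (pre ++ map f xs) ++ f u ∷ f v ∷ map f ys ++ post ∎

  -- The product of two alternating functions is symmetric, hence invariant under permutations.
  alternating-↭ : ∀ (G : List A → ℤ) → Alternating G → ∀ {xs ys} → xs ↭ ys → F xs ℤ.* G xs ≡ F ys ℤ.* G ys
  alternating-↭ G G-alt = within []
    where
    FG : List A → ℤ
    FG zs = F zs ℤ.* G zs

    within : ∀ pre {xs ys} → xs ↭ ys → FG (pre ++ xs) ≡ FG (pre ++ ys)
    within pre Perm.refl = ≡.refl
    within pre (Perm.prep x p) =
      subst₂ (λ us vs → FG us ≡ FG vs) (≡.sym (snoc pre x _)) (≡.sym (snoc pre x _)) (within (pre ++ x ∷ []) p)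
    within pre {x ∷ y ∷ xs} {.y ∷ .x ∷ ys} (Perm.swap .x .y p) = begin
      FG (pre ++ x ∷ y ∷ xs)
        ≡⟨ cong₂ ℤ._*_ (F-alt pre xs x y) (G-alt pre xs x y) ⟩
      ℤ.- F (pre ++ y ∷ x ∷ xs) ℤ.* ℤ.- G (pre ++ y ∷ x ∷ xs)
        ≡⟨ neg-*-neg (F (pre ++ y ∷ x ∷ xs)) (G (pre ++ y ∷ x ∷ xs)) ⟩
      FG (pre ++ y ∷ x ∷ xs)
        ≡⟨ subst₂ (λ us vs → FG us ≡ FG vs) (ListP.++-assoc pre (y ∷ x ∷ []) _) (ListP.++-assoc pre (y ∷ x ∷ []) _)
                  (within (pre ++ y ∷ x ∷ []) p) ⟩
      FG (pre ++ y ∷ x ∷ ys) ∎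
    within pre (Perm.trans p q) = ≡.trans (within pre p) (within pre q)

alternating-sort : ∀ {a n} {A : Set a} (F : List A → ℤ) → Alternating F →
                   ∀ pre (f : Fin n → A) post S {xs} → xs ↭ lst S →
                   F (pre ++ map f xs ++ post) ℤ.* sgnSeq xs ≡ F (pre ++ map f (lst S) ++ post)
alternating-sort F F-alt pre f post S {xs} xs↭S = begin
  F′ xs ℤ.* sgnSeq xs
    ≡⟨ alternating-↭ F′ (alternating-context F F-alt pre f post) sgnSeq sgnSeq-alternating xs↭S ⟩
  F′ (lst S) ℤ.* sgnSeq (lst S)
    ≡⟨ cong (F′ (lst S) ℤ.*_) (sgnSeq-lst S) ⟩
  F′ (lst S) ℤ.* 1ℤ
    ≡⟨ ℤP.*-identityʳ _ ⟩
  F′ (lst S) ∎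
  where
  open ≡.≡-Reasoning
  F′ = λ zs → F (pre ++ map f zs ++ post)

lst-++ : ∀ {a b} (X : Subset a) (Y : Subset b) → lst (X ++ᵛ Y) ≡ map (_↑ˡ b) (lst X) ++ map (a ↑ʳ_) (lst Y)
suc-lst-++ : ∀ {a b} (X : Subset a) (Y : Subset b) →
             map Fin.suc (lst (X ++ᵛ Y)) ≡ map (_↑ˡ b) (map Fin.suc (lst X)) ++ map (suc a ↑ʳ_) (lst Y)
lst-++ []                Y = ≡.sym (ListP.map-id (lst Y))
lst-++ {suc a} {b} (true ∷ X)  Y = cong (Fin.zero ∷_) (suc-lst-++ X Y)
lst-++ {suc a} {b} (false ∷ X) Y = suc-lst-++ X Y

suc-lst-++ {a} {b} X Y = begin
  map Fin.suc (lst (X ++ᵛ Y))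
    ≡⟨ cong (map Fin.suc) (lst-++ X Y) ⟩
  map Fin.suc (map (_↑ˡ b) (lst X) ++ map (a ↑ʳ_) (lst Y))
    ≡⟨ ListP.map-++ Fin.suc (map (_↑ˡ b) (lst X)) _ ⟩
  map Fin.suc (map (_↑ˡ b) (lst X)) ++ map Fin.suc (map (a ↑ʳ_) (lst Y))
    ≡⟨ cong₂ _++_ (≡.trans (≡.sym (ListP.map-∘ (lst X))) (ListP.map-∘ (lst X))) (≡.sym (ListP.map-∘ (lst Y))) ⟩
  map (_↑ˡ b) (map Fin.suc (lst X)) ++ map (suc a ↑ʳ_) (lst Y) ∎
  where open ≡.≡-Reasoning

lst-⊥ : ∀ n → lst (⊥ {n}) ≡ []
lst-⊥ zero    = ≡.refl
lst-⊥ (suc n) = cong (map Fin.suc) (lst-⊥ n)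

lst-⊤ : ∀ n → lst (⊤ {n}) ≡ allFin n
lst-⊤ zero    = ≡.refl
lst-⊤ (suc n) = cong (Fin.zero ∷_) (≡.trans (cong (map Fin.suc) (lst-⊤ n)) (ListP.map-tabulate id Fin.suc))

lst-++⊥ : ∀ {a} b (X : Subset a) → lst (X ++ᵛ ⊥ {b}) ≡ map (_↑ˡ b) (lst X)
lst-++⊥ {a} b X = ≡.trans (lst-++ X ⊥) (≡.trans (cong (λ zs → map (_↑ˡ b) (lst X) ++ map (a ↑ʳ_) zs) (lst-⊥ b))
                                             (ListP.++-identityʳ _))

lst-⊥++ : ∀ a {b} (Y : Subset b) → lst (⊥ {a} ++ᵛ Y) ≡ map (a ↑ʳ_) (lst Y)
lst-⊥++ a {b} Y = ≡.trans (lst-++ ⊥ Y) (cong (λ zs → map (_↑ˡ b) zs ++ map (a ↑ʳ_) (lst Y)) (lst-⊥ a))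

setOf-suc : ∀ {n} (xs : List (Fin n)) → setOf (map Fin.suc xs) ≡ false ∷ setOf xs
setOf-suc []       = ≡.refl
setOf-suc (x ∷ xs) = cong (⁅ Fin.suc x ⁆ ∪_) (setOf-suc xs)

setOf-lst : ∀ {n} (S : Subset n) → setOf (lst S) ≡ S
setOf-lst []          = ≡.refl
setOf-lst (true ∷ S)  = ≡.trans (cong (⁅ Fin.zero ⁆ ∪_) (setOf-suc (lst S)))
                              (cong (true ∷_) (≡.trans (SubsetP.∪-identityˡ _) (setOf-lst S)))
setOf-lst (false ∷ S) = ≡.trans (setOf-suc (lst S)) (cong (false ∷_) (setOf-lst S))

setOf-++ : ∀ {n} (xs ys : List (Fin n)) → setOf (xs ++ ys) ≡ setOf xs ∪ setOf ys
setOf-++ []       ys = ≡.sym (SubsetP.∪-identityˡ _)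
setOf-++ (x ∷ xs) ys = ≡.trans (cong (⁅ x ⁆ ∪_) (setOf-++ xs ys)) (≡.sym (SubsetP.∪-assoc ⁅ x ⁆ _ _))

length-lst : ∀ {n} (S : Subset n) → length (lst S) ≡ ∣ S ∣
length-lst []          = ≡.refl
length-lst (true ∷ S)  = cong suc (≡.trans (ListP.length-map Fin.suc (lst S)) (length-lst S))
length-lst (false ∷ S) = ≡.trans (ListP.length-map Fin.suc (lst S)) (length-lst S)

∈-lst : ∀ {n} {i : Fin n} {S : Subset n} → i Subset.∈ S → i ∈ lst S
∈-lst {i = Fin.zero}  {true ∷ S}  Vec.here      = here ≡.refl
∈-lst {i = Fin.suc i} {true ∷ S}  (Vec.there p) = there (∈P.∈-map⁺ Fin.suc (∈-lst p))
∈-lst {i = Fin.suc i} {false ∷ S} (Vec.there p) = ∈P.∈-map⁺ Fin.suc (∈-lst p)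

∈-setOf : ∀ {n} {x : Fin n} (xs : List (Fin n)) → x Subset.∈ setOf xs → x ∈ xs
∈-setOf []       x∈ = contradiction x∈ SubsetP.∉⊥
∈-setOf (y ∷ xs) x∈ with SubsetP.x∈p∪q⁻ ⁅ y ⁆ (setOf xs) x∈
... | inj₁ x∈⁅y⁆ = here (SubsetP.x∈⁅y⁆⇒x≡y y x∈⁅y⁆)
... | inj₂ x∈xs  = there (∈-setOf xs x∈xs)

∣⁅x⁆∪p∣≡1+∣p∣ : ∀ {n} (x : Fin n) (p : Subset n) → x Subset.∉ p → ∣ ⁅ x ⁆ ∪ p ∣ ≡ suc ∣ p ∣
∣⁅x⁆∪p∣≡1+∣p∣ Fin.zero    (true ∷ p)  x∉p = contradiction Vec.here x∉p
∣⁅x⁆∪p∣≡1+∣p∣ Fin.zero    (false ∷ p) x∉p = cong (suc ∘ ∣_∣) (SubsetP.∪-identityˡ p)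
∣⁅x⁆∪p∣≡1+∣p∣ (Fin.suc x) (true ∷ p)  x∉p = cong suc (∣⁅x⁆∪p∣≡1+∣p∣ x p (x∉p ∘ Vec.there))
∣⁅x⁆∪p∣≡1+∣p∣ (Fin.suc x) (false ∷ p) x∉p = ∣⁅x⁆∪p∣≡1+∣p∣ x p (x∉p ∘ Vec.there)

∣setOf∣ : ∀ {n} (xs : List (Fin n)) → Unique xs → ∣ setOf xs ∣ ≡ length xs
∣setOf∣ {n} []       _          = SubsetP.∣⊥∣≡0 n
∣setOf∣     (x ∷ xs) (x∉ ∷ u) =
  ≡.trans (∣⁅x⁆∪p∣≡1+∣p∣ x (setOf xs) (λ x∈ → All.lookup x∉ (∈-setOf xs x∈) ≡.refl))
          (cong suc (∣setOf∣ xs u))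

lst-∁-↭ : ∀ {n} (S : Subset n) → lst S ++ lst (∁ S) ↭ lst (⊤ {n})
suc-lst-∁-↭ : ∀ {n} (S : Subset n) → map Fin.suc (lst S) ++ map Fin.suc (lst (∁ S)) ↭ map Fin.suc (lst (⊤ {n}))
lst-∁-↭ []          = Perm.refl
lst-∁-↭ (true ∷ S)  = Perm.prep Fin.zero (suc-lst-∁-↭ S)
lst-∁-↭ (false ∷ S) = ↭-trans (PermP.shift Fin.zero (map Fin.suc (lst S)) _) (Perm.prep Fin.zero (suc-lst-∁-↭ S))

suc-lst-∁-↭ S = ↭-trans (↭-reflexive (≡.sym (ListP.map-++ Fin.suc (lst S) _))) (PermP.map⁺ Fin.suc (lst-∁-↭ S))

∪-++ : ∀ {a b} (x c : Subset a) (y d : Subset b) → (x ++ᵛ y) ∪ (c ++ᵛ d) ≡ (x ∪ c) ++ᵛ (y ∪ d)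
∪-++ []      []      y d = ≡.refl
∪-++ (u ∷ x) (v ∷ c) y d = cong (_ ∷_) (∪-++ x c y d)

++⊥-∪-⊥++ : ∀ {a b} (X : Subset a) (Y : Subset b) → (X ++ᵛ ⊥) ∪ (⊥ ++ᵛ Y) ≡ X ++ᵛ Y
++⊥-∪-⊥++ X Y = ≡.trans (∪-++ X ⊥ ⊥ Y) (cong₂ _++ᵛ_ (SubsetP.∪-identityʳ X) (SubsetP.∪-identityˡ Y))

∁-involutive : ∀ {n} (S : Subset n) → ∁ (∁ S) ≡ S
∁-involutive []          = ≡.refl
∁-involutive (true ∷ S)  = cong (true ∷_) (∁-involutive S)
∁-involutive (false ∷ S) = cong (false ∷_) (∁-involutive S)

∪≡⊤⇒meet : ∀ {n} (S T : Subset n) → S ∪ T ≡ ⊤ → T ≢ ∁ S → Σ (Fin n) λ e → e Subset.∈ S × e Subset.∈ T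
∪≡⊤⇒meet []          []          _   T≢∁S = contradiction ≡.refl T≢∁S
∪≡⊤⇒meet (true ∷ S)  (true ∷ T)  _   _    = Fin.zero , Vec.here , Vec.here
∪≡⊤⇒meet (true ∷ S)  (false ∷ T) S∪T T≢∁S
  with ∪≡⊤⇒meet S T (VecP.∷-injectiveʳ S∪T) (T≢∁S ∘ cong (false ∷_))
... | e , e∈S , e∈T = Fin.suc e , Vec.there e∈S , Vec.there e∈T
∪≡⊤⇒meet (false ∷ S) (true ∷ T)  S∪T T≢∁S
  with ∪≡⊤⇒meet S T (VecP.∷-injectiveʳ S∪T) (T≢∁S ∘ cong (true ∷_))
... | e , e∈S , e∈T = Fin.suc e , Vec.there e∈S , Vec.there e∈T

allSubsets-complete : ∀ n (S : Subset n) → S ∈ allSubsets n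
allSubsets-complete zero    []      = here ≡.refl
allSubsets-complete (suc n) (true ∷ S)  = ∈P.∈-++⁺ˡ (∈P.∈-map⁺ (true ∷_) (allSubsets-complete n S))
allSubsets-complete (suc n) (false ∷ S) =
  ∈P.∈-++⁺ʳ (map (true ∷_) (allSubsets n)) (∈P.∈-map⁺ (false ∷_) (allSubsets-complete n S))

∣∪∣-disjoint : ∀ {n} (A B : Subset n) → Unique (lst A ++ lst B) → ∣ A ∪ B ∣ ≡ ∣ A ∣ ℕ.+ ∣ B ∣
∣∪∣-disjoint A B u = begin
  ∣ A ∪ B ∣                          ≡⟨ cong ∣_∣ (cong₂ _∪_ (setOf-lst A) (setOf-lst B)) ⟨
  ∣ setOf (lst A) ∪ setOf (lst B) ∣  ≡⟨ cong ∣_∣ (setOf-++ (lst A) (lst B)) ⟨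
  ∣ setOf (lst A ++ lst B) ∣         ≡⟨ ∣setOf∣ (lst A ++ lst B) u ⟩
  length (lst A ++ lst B)            ≡⟨ ListP.length-++ (lst A) ⟩
  length (lst A) ℕ.+ length (lst B)  ≡⟨ cong₂ ℕ._+_ (length-lst A) (length-lst B) ⟩
  ∣ A ∣ ℕ.+ ∣ B ∣                    ∎
  where open ≡.≡-Reasoning

p⊆q⇒∣q∣≤∣p∣⇒p≡q : ∀ {n} {p q : Subset n} → p ⊆ q → ∣ q ∣ ≤ ∣ p ∣ → p ≡ q
p⊆q⇒∣q∣≤∣p∣⇒p≡q {p = []}        {[]}        _   _   = ≡.refl
p⊆q⇒∣q∣≤∣p∣⇒p≡q {p = true ∷ p}  {true ∷ q}  p⊆q q≤p =
  cong (true ∷_) (p⊆q⇒∣q∣≤∣p∣⇒p≡q (SubsetP.drop-∷-⊆ p⊆q) (ℕP.≤-pred q≤p))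
p⊆q⇒∣q∣≤∣p∣⇒p≡q {p = false ∷ p} {false ∷ q} p⊆q q≤p =
  cong (false ∷_) (p⊆q⇒∣q∣≤∣p∣⇒p≡q (SubsetP.drop-∷-⊆ p⊆q) q≤p)
p⊆q⇒∣q∣≤∣p∣⇒p≡q {p = true ∷ p}  {false ∷ q} p⊆q _   with p⊆q Vec.here
... | ()
p⊆q⇒∣q∣≤∣p∣⇒p≡q {p = false ∷ p} {true ∷ q}  p⊆q q≤p =
  contradiction (ℕP.≤-trans q≤p (SubsetP.p⊆q⇒∣p∣≤∣q∣ (SubsetP.drop-∷-⊆ p⊆q))) ℕP.1+n≰n

∣⊥++p∣≡∣p∣ : ∀ {a b} (S : Subset b) → ∣ ⊥ {a} ++ᵛ S ∣ ≡ ∣ S ∣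
∣⊥++p∣≡∣p∣ {ℕ.zero}  S = ≡.refl
∣⊥++p∣≡∣p∣ {ℕ.suc a} S = ∣⊥++p∣≡∣p∣ {a} S

++-mono-⊆ : ∀ {a b} {X X′ : Subset a} {S S′ : Subset b} → X ⊆ X′ → S ⊆ S′ → X ++ᵛ S ⊆ X′ ++ᵛ S′
++-mono-⊆ {X = []}    {[]}     _    S⊆S′ x∈ = S⊆S′ x∈
++-mono-⊆ {X = _ ∷ X} {_ ∷ X′} X⊆X′ S⊆S′ Vec.here with X⊆X′ Vec.here
... | Vec.here = Vec.here
++-mono-⊆ {X = _ ∷ X} {_ ∷ X′} X⊆X′ S⊆S′ (Vec.there x∈) =
  Vec.there (++-mono-⊆ (SubsetP.drop-∷-⊆ X⊆X′) S⊆S′ x∈)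

module _ {n : ℕ} (N : Subset n → ℤ) where

  private
    basis? : ∀ I → Dec (Any.Any (λ B → I ⊆ B × N B ≢ 0ℤ) (allSubsets n))
    basis? I = any? (λ B → (I ⊆? B) ×-dec ¬? (N B ℤ.≟ 0ℤ)) (allSubsets n)

  independent-⊆-basis : ∀ {I B} → I ⊆ B → N B ≢ 0ℤ → isIndep N I ≡ true
  independent-⊆-basis {I} {B} I⊆B N[B]≢0 = dec-true (basis? I) (lose (allSubsets-complete n B) (I⊆B , N[B]≢0))

  independent⇒⊆-basis : ∀ {I} → isIndep N I ≡ true → ∃ λ B → I ⊆ B × N B ≢ 0ℤ
  independent⇒⊆-basis {I} indep with basis? I
  ... | yes I⊆basis = Any.satisfied I⊆basis

  module _ (X : Subset n) where

    private
      step : Subset n → ℕ → ℕ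
      step I k = if does (I ⊆? X) Bool.∧ isIndep N I then ∣ I ∣ ℕ.⊔ k else k

      step-≥ : ∀ J k → k ≤ step J k
      step-≥ J k with does (J ⊆? X) Bool.∧ isIndep N J
      ... | true  = ℕP.m≤n⊔m ∣ J ∣ k
      ... | false = ℕP.≤-refl

      fold-≥ : ∀ {Is I} → I ∈ Is → I ⊆ X → isIndep N I ≡ true → ∣ I ∣ ≤ foldr step 0 Is
      fold-≥ {I ∷ Is} (here ≡.refl) I⊆X indep with I ⊆? X
      ... | yes _   rewrite indep = ℕP.m≤m⊔n ∣ I ∣ _
      ... | no I⊈X  = contradiction (λ {x} → I⊆X {x}) I⊈X
      fold-≥ {J ∷ Is} (there I∈Is) I⊆X indep = ℕP.≤-trans (fold-≥ I∈Is I⊆X indep) (step-≥ J _)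

      fold-≤ : ∀ Is {k} → (∀ I → I ⊆ X → isIndep N I ≡ true → ∣ I ∣ ≤ k) → foldr step 0 Is ≤ k
      fold-≤ []       bound = ℕ.z≤n
      fold-≤ (I ∷ Is) bound with I ⊆? X
      ... | no _    = fold-≤ Is bound
      ... | yes I⊆X with isIndep N I in indep
      ...   | true  = ℕP.⊔-lub (bound I I⊆X indep) (fold-≤ Is bound)
      ...   | false = fold-≤ Is bound

    independent-≤-rank : ∀ {I} → I ⊆ X → isIndep N I ≡ true → ∣ I ∣ ≤ rank N X
    independent-≤-rank = fold-≥ (allSubsets-complete n _)

    rank-≤ : ∀ {k} → (∀ I → I ⊆ X → isIndep N I ≡ true → ∣ I ∣ ≤ k) → rank N X ≤ k
    rank-≤ = fold-≤ (allSubsets n)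

  rank-mono : ∀ {X Y} → X ⊆ Y → rank N X ≤ rank N Y
  rank-mono {X} {Y} X⊆Y = rank-≤ X (λ I I⊆X → independent-≤-rank Y (X⊆Y ∘ I⊆X))

  rank-≤-basis-size : ∀ {k} → (∀ B → N B ≢ 0ℤ → ∣ B ∣ ≡ k) → ∀ X → rank N X ≤ k
  rank-≤-basis-size {k} basis-size X = rank-≤ X λ I _ indep →
    let B , I⊆B , N[B]≢0 = independent⇒⊆-basis indep
    in subst (∣ I ∣ ≤_) (basis-size B N[B]≢0) (SubsetP.p⊆q⇒∣p∣≤∣q∣ I⊆B)

module Arithmetic {c ℓ : Level} (R : CommutativeRing c ℓ) where

  open CommutativeRing R
  open Ext R
  open import Algebra.Properties.Ring ring using (-‿distribˡ-*; -‿distribʳ-*; -‿involutive; -0#≈0#)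
  open import Algebra.Properties.Semiring.Mult semiring using (×1-homo-*) renaming (_×_ to _×ₙ_)
  open CommutativeSemigroupProperties +-commutativeSemigroup using () renaming (interchange to +-interchange)
  open import Relation.Binary.Reasoning.Setoid setoid

  ≡⇒≈ : ∀ {x y} → x ≡ y → x ≈ y
  ≡⇒≈ ≡.refl = refl

  natR≡×1 : ∀ k → natR k ≡ k ×ₙ 1#
  natR≡×1 zero    = ≡.refl
  natR≡×1 (suc k) = cong (1# +_) (natR≡×1 k)

  natR-* : ∀ a b → natR (a ℕ.* b) ≈ natR a * natR b
  natR-* a b = begin
    natR (a ℕ.* b)         ≡⟨ natR≡×1 (a ℕ.* b) ⟩
    (a ℕ.* b) ×ₙ 1#        ≈⟨ ×1-homo-* a b ⟩
    (a ×ₙ 1#) * (b ×ₙ 1#)  ≡⟨ cong₂ _*_ (natR≡×1 a) (natR≡×1 b) ⟨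
    natR a * natR b        ∎

  fromℤ-neg : ∀ i → fromℤ (ℤ.- i) ≈ - fromℤ i
  fromℤ-neg (ℤ.+ zero)  = sym -0#≈0#
  fromℤ-neg (ℤ.+ suc k) = refl
  fromℤ-neg ℤ.-[1+ k ]  = sym (-‿involutive _)

  private
    fromℤ-+-* : ∀ a j → fromℤ (ℤ.+ a ℤ.* j) ≈ natR a * fromℤ j
    fromℤ-+-* a (ℤ.+ b) = begin
      fromℤ (ℤ.+ a ℤ.* ℤ.+ b)  ≡⟨ cong fromℤ (ℤP.pos-* a b) ⟨
      natR (a ℕ.* b)           ≈⟨ natR-* a b ⟩
      natR a * natR b          ∎
    fromℤ-+-* a ℤ.-[1+ b ] = begin
      fromℤ (ℤ.+ a ℤ.* ℤ.- ℤ.+ suc b)    ≡⟨ cong fromℤ (ℤP.neg-distribʳ-* (ℤ.+ a) (ℤ.+ suc b)) ⟨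
      fromℤ (ℤ.- (ℤ.+ a ℤ.* ℤ.+ suc b))  ≈⟨ fromℤ-neg (ℤ.+ a ℤ.* ℤ.+ suc b) ⟩
      - fromℤ (ℤ.+ a ℤ.* ℤ.+ suc b)      ≈⟨ -‿cong (fromℤ-+-* a (ℤ.+ suc b)) ⟩
      - (natR a * natR (suc b))          ≈⟨ -‿distribʳ-* _ _ ⟩
      natR a * - natR (suc b)            ∎

  fromℤ-* : ∀ i j → fromℤ (i ℤ.* j) ≈ fromℤ i * fromℤ j
  fromℤ-* (ℤ.+ a)    j = fromℤ-+-* a j
  fromℤ-* ℤ.-[1+ a ] j = begin
    fromℤ (ℤ.- ℤ.+ suc a ℤ.* j)    ≡⟨ cong fromℤ (ℤP.neg-distribˡ-* (ℤ.+ suc a) j) ⟨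
    fromℤ (ℤ.- (ℤ.+ suc a ℤ.* j))  ≈⟨ fromℤ-neg (ℤ.+ suc a ℤ.* j) ⟩
    - fromℤ (ℤ.+ suc a ℤ.* j)      ≈⟨ -‿cong (fromℤ-+-* (suc a) j) ⟩
    - (natR (suc a) * fromℤ j)     ≈⟨ -‿distribˡ-* _ _ ⟩
    - natR (suc a) * fromℤ j       ∎

  fromℤ-1 : fromℤ 1ℤ ≈ 1#
  fromℤ-1 = +-identityʳ 1#

  [yes] : ∀ {p} {P : Set p} (d : Dec P) → P → [ d ]? ≡ 1#
  [yes] (yes _) _ = ≡.refl
  [yes] (no ¬p) p = contradiction p ¬p

  [no] : ∀ {p} {P : Set p} (d : Dec P) → ¬ P → [ d ]? ≡ 0#
  [no] (yes p) ¬p = contradiction p ¬p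
  [no] (no _)  _  = ≡.refl

  [no]-* : ∀ {p} {P : Set p} (d : Dec P) → ¬ P → ∀ x → [ d ]? * x ≈ 0#
  [no]-* d ¬p x = trans (*-congʳ (≡⇒≈ ([no] d ¬p))) (zeroˡ x)

  module _ {a} {A : Set a} where

    ΣL-cong : ∀ (xs : List A) {f g : A → Carrier} → (∀ x → f x ≈ g x) → ΣL xs f ≈ ΣL xs g
    ΣL-cong []       f≈g = refl
    ΣL-cong (x ∷ xs) f≈g = +-cong (f≈g x) (ΣL-cong xs f≈g)

    ΣL-zero : ∀ (xs : List A) {f : A → Carrier} → (∀ x → f x ≈ 0#) → ΣL xs f ≈ 0#
    ΣL-zero []       f≈0 = refl
    ΣL-zero (x ∷ xs) f≈0 = trans (+-cong (f≈0 x) (ΣL-zero xs f≈0)) (+-identityˡ 0#)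

    ΣL-++ : ∀ (xs ys : List A) (f : A → Carrier) → ΣL (xs ++ ys) f ≈ ΣL xs f + ΣL ys f
    ΣL-++ []       ys f = sym (+-identityˡ _)
    ΣL-++ (x ∷ xs) ys f = trans (+-congˡ (ΣL-++ xs ys f)) (sym (+-assoc _ _ _))

    ΣL-map : ∀ {b} {B : Set b} (h : B → A) (xs : List B) (f : A → Carrier) → ΣL (map h xs) f ≡ ΣL xs (f ∘ h)
    ΣL-map h []       f = ≡.refl
    ΣL-map h (x ∷ xs) f = cong (f (h x) +_) (ΣL-map h xs f)

    ΠL-++ : ∀ (xs ys : List A) (f : A → Carrier) → ΠL (xs ++ ys) f ≈ ΠL xs f * ΠL ys f
    ΠL-++ []       ys f = sym (*-identityˡ _)
    ΠL-++ (x ∷ xs) ys f = trans (*-congˡ (ΠL-++ xs ys f)) (sym (*-assoc _ _ _))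

    ΠL-map : ∀ {b} {B : Set b} (h : B → A) (xs : List B) (f : A → Carrier) → ΠL (map h xs) f ≡ ΠL xs (f ∘ h)
    ΠL-map h []       f = ≡.refl
    ΠL-map h (x ∷ xs) f = cong (f (h x) *_) (ΠL-map h xs f)

    ΠL-cong : ∀ (xs : List A) {f g : A → Carrier} → (∀ x → f x ≈ g x) → ΠL xs f ≈ ΠL xs g
    ΠL-cong []       f≈g = refl
    ΠL-cong (x ∷ xs) f≈g = *-cong (f≈g x) (ΠL-cong xs f≈g)

    ΠL-1 : ∀ (xs : List A) → ΠL xs (λ _ → 1#) ≈ 1#
    ΠL-1 []       = refl
    ΠL-1 (x ∷ xs) = trans (*-congˡ (ΠL-1 xs)) (*-identityˡ 1#)

  ΣL-+ : ∀ {a} {A : Set a} (xs : List A) (f g : A → Carrier) → ΣL xs f + ΣL xs g ≈ ΣL xs (λ x → f x + g x)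
  ΣL-+ []       f g = +-identityˡ 0#
  ΣL-+ (x ∷ xs) f g = trans (+-interchange (f x) _ (g x) _) (+-congˡ (ΣL-+ xs f g))

  ΣL-swap : ∀ {a b} {A : Set a} {B : Set b} (xs : List A) (ys : List B) (f : A → B → Carrier) →
            ΣL xs (λ x → ΣL ys (f x)) ≈ ΣL ys (λ y → ΣL xs (λ x → f x y))
  ΣL-swap []       ys f = sym (ΣL-zero ys (λ _ → refl))
  ΣL-swap (x ∷ xs) ys f = trans (+-congˡ (ΣL-swap xs ys f)) (ΣL-+ ys (f x) _)

  ΣΛ-at : ∀ {a} {A : Set a} {n} (xs : List A) (f : A → Λ n) C → ΣΛ xs f C ≡ ΣL xs (λ x → f x C)
  ΣΛ-at []       f C = ≡.refl
  ΣΛ-at (x ∷ xs) f C = cong (f x C +_) (ΣΛ-at xs f C)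

  ΣL-allSubsets-suc : ∀ n (f : Subset (suc n) → Carrier) →
                      ΣL (allSubsets (suc n)) f ≈ ΣL (allSubsets n) (f ∘ (true ∷_)) + ΣL (allSubsets n) (f ∘ (false ∷_))
  ΣL-allSubsets-suc n f = trans (ΣL-++ (map (true ∷_) (allSubsets n)) _ f)
                                (≡⇒≈ (cong₂ _+_ (ΣL-map (true ∷_) (allSubsets n) f) (ΣL-map (false ∷_) (allSubsets n) f)))

  ΣL-split : ∀ a b (f : Subset (a ℕ.+ b) → Carrier) →
             ΣL (allSubsets (a ℕ.+ b)) f ≈ ΣL (allSubsets a) (λ X → ΣL (allSubsets b) (λ Y → f (X ++ᵛ Y)))
  ΣL-split zero    b f = sym (+-identityʳ _)
  ΣL-split (suc a) b f = begin
    ΣL (allSubsets (suc a ℕ.+ b)) f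
      ≈⟨ ΣL-allSubsets-suc (a ℕ.+ b) f ⟩
    ΣL (allSubsets (a ℕ.+ b)) (f ∘ (true ∷_)) + ΣL (allSubsets (a ℕ.+ b)) (f ∘ (false ∷_))
      ≈⟨ +-cong (ΣL-split a b (f ∘ (true ∷_))) (ΣL-split a b (f ∘ (false ∷_))) ⟩
    ΣL (allSubsets a) (g ∘ (true ∷_)) + ΣL (allSubsets a) (g ∘ (false ∷_))
      ≈⟨ ΣL-allSubsets-suc a g ⟨
    ΣL (allSubsets (suc a)) g ∎
    where g = λ X → ΣL (allSubsets b) (λ Y → f (X ++ᵛ Y))

  ΣL-collapse : ∀ n (W : Subset n) {f : Subset n → Carrier} → (∀ Z → Z ≢ W → f Z ≈ 0#) →
                ΣL (allSubsets n) f ≈ f W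
  ΣL-collapse zero    []      f-off = +-identityʳ _
  ΣL-collapse (suc n) (w ∷ W) {f} f-off = trans (ΣL-allSubsets-suc n f) (by-head w f-off)
    where
    tail-off : ∀ b → (∀ Z → Z ≢ b ∷ W → f Z ≈ 0#) → ∀ Z → Z ≢ W → f (b ∷ Z) ≈ 0#
    tail-off b off Z Z≢W = off (b ∷ Z) (Z≢W ∘ VecP.∷-injectiveʳ)

    by-head : ∀ w → (∀ Z → Z ≢ w ∷ W → f Z ≈ 0#) →
              ΣL (allSubsets n) (f ∘ (true ∷_)) + ΣL (allSubsets n) (f ∘ (false ∷_)) ≈ f (w ∷ W)
    by-head true  off = trans (+-cong (ΣL-collapse n W (tail-off true off))
                                      (ΣL-zero (allSubsets n) (λ Z → off (false ∷ Z) (λ ()))))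
                              (+-identityʳ _)
    by-head false off = trans (+-cong (ΣL-zero (allSubsets n) (λ Z → off (true ∷ Z) (λ ())))
                                      (ΣL-collapse n W (tail-off false off)))
                              (+-identityˡ _)

-- Exterior products of relabelled elements

record SortedImage {n k} (f : Fin n → Fin k) : Set where
  field
    image           : Subset n → Subset k
    lst-image       : ∀ A → map f (lst A) ≡ lst (image A)
    image-injective : ∀ {A B} → image A ≡ image B → A ≡ B

take-++ : ∀ {l} {A : Set l} {a b} (xs : Vec A a) (ys : Vec A b) → take a (xs ++ᵛ ys) ≡ xs
take-++ {a = a} xs ys = VecP.++-injectiveˡ (take a (xs ++ᵛ ys)) xs (VecP.take++drop≡id a (xs ++ᵛ ys))

drop-++ : ∀ {l} {A : Set l} {a b} (xs : Vec A a) (ys : Vec A b) → drop a (xs ++ᵛ ys) ≡ ys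
drop-++ {a = a} xs ys = VecP.++-injectiveʳ (take a (xs ++ᵛ ys)) xs (VecP.take++drop≡id a (xs ++ᵛ ys))

↑ˡ-image : ∀ {a} b → SortedImage {a} (_↑ˡ b)
↑ˡ-image b = record
  { image           = λ X → X ++ᵛ ⊥ {b}
  ; lst-image       = λ X → ≡.sym (lst-++⊥ b X)
  ; image-injective = VecP.++-injectiveˡ _ _
  }

↑ʳ-image : ∀ a {b} → SortedImage (_↑ʳ_ {b} a)
↑ʳ-image a = record
  { image           = λ Y → ⊥ {a} ++ᵛ Y
  ; lst-image       = λ Y → ≡.sym (lst-⊥++ a Y)
  ; image-injective = VecP.++-injectiveʳ ⊥ ⊥
  }

module _ {a a′ b} {f : Fin a → Fin a′} (I : SortedImage f) (g : Fin (a ℕ.+ b) → Fin (a′ ℕ.+ b))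
         (g-↑ˡ : ∀ i → g (i ↑ˡ b) ≡ f i ↑ˡ b) (g-↑ʳ : ∀ e → g (a ↑ʳ e) ≡ a′ ↑ʳ e) where

  open SortedImage I

  blockwise-image : SortedImage g
  blockwise-image = record
    { image           = image′
    ; lst-image       = lst-image′
    ; image-injective = injective
    }
    where
    image′ : Subset (a ℕ.+ b) → Subset (a′ ℕ.+ b)
    image′ A = image (take a A) ++ᵛ drop a A

    lst-image′ : ∀ A → map g (lst A) ≡ lst (image′ A)
    lst-image′ A = begin
      map g (lst A)
        ≡⟨ cong (map g ∘ lst) (VecP.take++drop≡id a A) ⟨
      map g (lst (X ++ᵛ S))
        ≡⟨ cong (map g) (lst-++ X S) ⟩
      map g (map (_↑ˡ b) (lst X) ++ map (a ↑ʳ_) (lst S))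
        ≡⟨ ListP.map-++ g (map (_↑ˡ b) (lst X)) _ ⟩
      map g (map (_↑ˡ b) (lst X)) ++ map g (map (a ↑ʳ_) (lst S))
        ≡⟨ cong₂ _++_ (≡.sym (ListP.map-∘ (lst X))) (≡.sym (ListP.map-∘ (lst S))) ⟩
      map (g ∘ (_↑ˡ b)) (lst X) ++ map (g ∘ (a ↑ʳ_)) (lst S)
        ≡⟨ cong₂ _++_ (ListP.map-cong g-↑ˡ (lst X)) (ListP.map-cong g-↑ʳ (lst S)) ⟩
      map ((_↑ˡ b) ∘ f) (lst X) ++ map (a′ ↑ʳ_) (lst S)
        ≡⟨ cong (_++ map (a′ ↑ʳ_) (lst S)) (ListP.map-∘ (lst X)) ⟩
      map (_↑ˡ b) (map f (lst X)) ++ map (a′ ↑ʳ_) (lst S)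
        ≡⟨ cong (λ xs → map (_↑ˡ b) xs ++ map (a′ ↑ʳ_) (lst S)) (lst-image X) ⟩
      map (_↑ˡ b) (lst (image X)) ++ map (a′ ↑ʳ_) (lst S)
        ≡⟨ lst-++ (image X) S ⟨
      lst (image′ A) ∎
      where
      open ≡.≡-Reasoning
      X = take a A
      S = drop a A

    injective : ∀ {A B} → image′ A ≡ image′ B → A ≡ B
    injective {A} {B} eq = begin
      A                      ≡⟨ VecP.take++drop≡id a A ⟨
      take a A ++ᵛ drop a A  ≡⟨ cong₂ _++ᵛ_ (image-injective (VecP.++-injectiveˡ _ _ eq)) (VecP.++-injectiveʳ _ _ eq) ⟩
      take a B ++ᵛ drop a B  ≡⟨ VecP.take++drop≡id a B ⟩
      B                      ∎
      where open ≡.≡-Reasoning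

  blockwise-image-++ : ∀ X S → SortedImage.image blockwise-image (X ++ᵛ S) ≡ image X ++ᵛ S
  blockwise-image-++ X S = cong₂ (λ X′ S′ → image X′ ++ᵛ S′) (take-++ X S) (drop-++ X S)

module Exterior {c ℓ : Level} (R : CommutativeRing c ℓ) where

  open CommutativeRing R
  open Ext R
  open Arithmetic R
  open import Relation.Binary.Reasoning.Setoid setoid

  plk-lst : ∀ {n} (x : Λ n) S → plk x (lst S) ≈ x S
  plk-lst x S = begin
    fromℤ (sgnSeq (lst S)) * x (setOf (lst S)) ≡⟨ cong₂ (λ s T → fromℤ s * x T) (sgnSeq-lst S) (setOf-lst S) ⟩
    fromℤ 1ℤ * x S                             ≈⟨ *-congʳ fromℤ-1 ⟩
    1# * x S                                   ≈⟨ *-identityˡ (x S) ⟩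
    x S                                        ∎

  module _ {n k} {f : Fin n → Fin k} (I : SortedImage f) (a : Fin n → Carrier) (u : Λ n) where

    open SortedImage I

    private
      summand : ∀ C A → [ setOf (map f (lst A)) ≟S C ]? * (ΠL (lst A) a * (fromℤ (sgnSeq (map f (lst A))) * u A))
                      ≈ [ image A ≟S C ]? * (ΠL (lst A) a * u A)
      summand C A rewrite lst-image A | setOf-lst (image A) | sgnSeq-lst (image A) =
        *-congˡ (*-congˡ (trans (*-congʳ fromℤ-1) (*-identityˡ (u A))))

    relabel-image : ∀ A → relabel f a u (image A) ≈ ΠL (lst A) a * u A
    relabel-image A = begin
      relabel f a u (image A)
        ≈⟨ ΣL-cong (allSubsets n) (summand (image A)) ⟩
      ΣL (allSubsets n) (λ B → [ image B ≟S image A ]? * (ΠL (lst B) a * u B))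
        ≈⟨ ΣL-collapse n A (λ B B≢A → [no]-* (image B ≟S image A) (B≢A ∘ image-injective) _) ⟩
      [ image A ≟S image A ]? * (ΠL (lst A) a * u A)
        ≡⟨ cong (_* (ΠL (lst A) a * u A)) ([yes] (image A ≟S image A) ≡.refl) ⟩
      1# * (ΠL (lst A) a * u A)
        ≈⟨ *-identityˡ _ ⟩
      ΠL (lst A) a * u A ∎

    relabel-outside : ∀ C → (∀ A → image A ≢ C) → relabel f a u C ≈ 0#
    relabel-outside C C∉ = trans (ΣL-cong (allSubsets n) (summand C))
                                 (ΣL-zero (allSubsets n) (λ A → [no]-* (image A ≟S C) (C∉ A) _))

  ΣL-image : ∀ {n k} {f : Fin n → Fin k} (I : SortedImage f) {F : Subset k → Carrier} →
             (∀ C → (∀ A → SortedImage.image I A ≢ C) → F C ≈ 0#) →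
             ΣL (allSubsets k) F ≈ ΣL (allSubsets n) (F ∘ SortedImage.image I)
  ΣL-image {n} {k} I {F} F-outside = begin
    ΣL (allSubsets k) F
      ≈⟨ ΣL-cong (allSubsets k) (λ C → sym (image-indicator C)) ⟩
    ΣL (allSubsets k) (λ C → ΣL (allSubsets n) (λ A → [ image A ≟S C ]? * F C))
      ≈⟨ ΣL-swap (allSubsets k) (allSubsets n) _ ⟩
    ΣL (allSubsets n) (λ A → ΣL (allSubsets k) (λ C → [ image A ≟S C ]? * F C))
      ≈⟨ ΣL-cong (allSubsets n) (λ A → ΣL-collapse k (image A) (λ C C≢ → [no]-* (image A ≟S C) (C≢ ∘ ≡.sym) _)) ⟩
    ΣL (allSubsets n) (λ A → [ image A ≟S image A ]? * F (image A))
      ≈⟨ ΣL-cong (allSubsets n) (λ A → trans (*-congʳ (≡⇒≈ ([yes] (image A ≟S image A) ≡.refl))) (*-identityˡ _)) ⟩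
    ΣL (allSubsets n) (F ∘ image) ∎
    where
    open SortedImage I
    image-indicator : ∀ C → ΣL (allSubsets n) (λ A → [ image A ≟S C ]? * F C) ≈ F C
    image-indicator C with any? (λ A → image A ≟S C) (allSubsets n)
    ... | yes C∈ with Any.satisfied C∈
    ...   | A₀ , ≡.refl =
      trans (ΣL-collapse n A₀ (λ A A≢A₀ → [no]-* (image A ≟S image A₀) (A≢A₀ ∘ image-injective) _))
            (trans (*-congʳ (≡⇒≈ ([yes] (image A₀ ≟S image A₀) ≡.refl))) (*-identityˡ _))
    image-indicator C | no C∉ =
      trans (ΣL-zero (allSubsets n) (λ A → [no]-* (image A ≟S C) (C∉ ∘ lose (allSubsets-complete n A)) _))
            (sym (F-outside C (λ A → C∉ ∘ lose (allSubsets-complete n A))))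

  module _ {n₁ n₂ k} {f₁ : Fin n₁ → Fin k} {f₂ : Fin n₂ → Fin k}
           (I₁ : SortedImage f₁) (I₂ : SortedImage f₂)
           (a₁ : Fin n₁ → Carrier) (a₂ : Fin n₂ → Carrier) (u₁ : Λ n₁) (u₂ : Λ n₂) where

    open SortedImage I₁ using () renaming (image to image₁)
    open SortedImage I₂ using () renaming (image to image₂)

    ∧-relabel : ∀ C → (relabel f₁ a₁ u₁ ∧ relabel f₂ a₂ u₂) C ≈
      ΣL (allSubsets n₁) λ A → ΣL (allSubsets n₂) λ B →
        [ (image₁ A ∪ image₂ B) ≟S C ]? * (fromℤ (sgnSeq (lst (image₁ A) ++ lst (image₂ B)))
                                          * ((ΠL (lst A) a₁ * u₁ A) * (ΠL (lst B) a₂ * u₂ B)))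
    ∧-relabel C = begin
      ΣL (allSubsets k) (λ A′ → ΣL (allSubsets k) (term A′))
        ≈⟨ ΣL-image I₁ (λ A′ A′∉ → ΣL-zero (allSubsets k) (λ B′ →
             inner-zero (trans (*-congʳ (relabel-outside I₁ a₁ u₁ A′ A′∉)) (zeroˡ _)))) ⟩
      ΣL (allSubsets n₁) (λ A → ΣL (allSubsets k) (term (image₁ A)))
        ≈⟨ ΣL-cong (allSubsets n₁) (λ A → ΣL-image I₂ (λ B′ B′∉ →
             inner-zero (trans (*-congˡ (relabel-outside I₂ a₂ u₂ B′ B′∉)) (zeroʳ _)))) ⟩
      ΣL (allSubsets n₁) (λ A → ΣL (allSubsets n₂) (λ B → term (image₁ A) (image₂ B)))
        ≈⟨ ΣL-cong (allSubsets n₁) (λ A → ΣL-cong (allSubsets n₂) (λ B →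
             *-congˡ (*-congˡ (*-cong (relabel-image I₁ a₁ u₁ A) (relabel-image I₂ a₂ u₂ B))))) ⟩
      _ ∎
      where
      x = relabel f₁ a₁ u₁
      y = relabel f₂ a₂ u₂
      term : Subset k → Subset k → Carrier
      term A′ B′ = [ (A′ ∪ B′) ≟S C ]? * (fromℤ (sgnSeq (lst A′ ++ lst B′)) * (x A′ * y B′))
      inner-zero : ∀ {d s t} → t ≈ 0# → d * (s * t) ≈ 0#
      inner-zero {d} {s} t≈0 = trans (*-congˡ (trans (*-congˡ t≈0) (zeroʳ s))) (zeroʳ d)

  dual-at : ∀ {n} (ε : List (Fin n) → ℤ) (x : Subset n → ℤ) Y →
            dual ε (λ S → fromℤ (x S)) Y ≈ fromℤ (x (∁ Y)) * fromℤ (ε (lst (∁ Y) ++ lst Y))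
  dual-at ε x Y = *-congʳ (plk-lst (λ S → fromℤ (x S)) (∁ Y))

module Homogeneity {c ℓ : Level} (R : CommutativeRing c ℓ) where

  open CommutativeRing R
  open Ext R
  open Arithmetic R

  Homogeneous : ∀ {n} → ℕ → Λ n → Set ℓ
  Homogeneous k x = ∀ S → ∣ S ∣ ≢ k → x S ≈ 0#

  ·𝟏-homogeneous : ∀ {n} a → Homogeneous {n} 0 (a · 𝟏)
  ·𝟏-homogeneous {n} a S ∣S∣≢0 =
    trans (*-congˡ (≡⇒≈ ([no] (S ≟S ⊥) (∣S∣≢0 ∘ λ S≡⊥ → ≡.trans (cong ∣_∣ S≡⊥) (SubsetP.∣⊥∣≡0 n)))))
          (zeroʳ a)

  vec-homogeneous : ∀ {n} v → Homogeneous {n} 1 (vec v)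
  vec-homogeneous {n} v S ∣S∣≢1 = ΣL-zero (allFin n) λ i →
    [no]-* (S ≟S ⁅ i ⁆) (∣S∣≢1 ∘ λ S≡⁅i⁆ → ≡.trans (cong ∣_∣ S≡⁅i⁆) (SubsetP.∣⁅x⁆∣≡1 i)) (v i)

  ∧-homogeneous : ∀ {n} k l {x y : Λ n} → Homogeneous k x → Homogeneous l y → Homogeneous (k ℕ.+ l) (x ∧ y)
  ∧-homogeneous {n} k l {x} {y} x-hom y-hom C ∣C∣≢k+l =
    ΣL-zero (allSubsets n) λ A → ΣL-zero (allSubsets n) λ B → term A B ((A ∪ B) ≟S C)
    where
    term : ∀ A B (d : Dec (A ∪ B ≡ C)) → [ d ]? * (fromℤ (sgnSeq (lst A ++ lst B)) * (x A * y B)) ≈ 0#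
    term A B (no A∪B≢C)  = zeroˡ _
    term A B (yes A∪B≡C) =
      trans (*-identityˡ _) (by-cases (UniqueDec.unique? FinP._≟_ (lst A ++ lst B)) (∣ A ∣ ℕP.≟ k))
      where
      by-cases : Dec (Unique (lst A ++ lst B)) → Dec (∣ A ∣ ≡ k) →
                 fromℤ (sgnSeq (lst A ++ lst B)) * (x A * y B) ≈ 0#
      by-cases (no ¬u) _ = trans (*-congʳ (≡⇒≈ (cong fromℤ (sgnSeq-nonunique ¬u)))) (zeroˡ _)
      by-cases (yes u) (no ∣A∣≢k) = trans (*-congˡ (trans (*-congʳ (x-hom A ∣A∣≢k)) (zeroˡ _))) (zeroʳ _)
      by-cases (yes u) (yes ∣A∣≡k) = trans (*-congˡ (trans (*-congˡ (y-hom B ∣B∣≢l)) (zeroʳ _))) (zeroʳ _)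
        where
        ∣B∣≢l : ∣ B ∣ ≢ l
        ∣B∣≢l ∣B∣≡l = ∣C∣≢k+l (≡.trans (≡.sym (cong ∣_∣ A∪B≡C))
                               (≡.trans (∣∪∣-disjoint A B u) (cong₂ ℕ._+_ ∣A∣≡k ∣B∣≡l)))

  wedgeAll-homogeneous : ∀ {n} (vs : List (Fin n → Carrier)) → Homogeneous (length vs) (wedgeAll vs)
  wedgeAll-homogeneous []       S ∣S∣≢0 = trans (sym (*-identityˡ _)) (·𝟏-homogeneous 1# S ∣S∣≢0)
  wedgeAll-homogeneous (v ∷ vs) =
    ∧-homogeneous 1 (length vs) (vec-homogeneous v) (wedgeAll-homogeneous vs)

private
  module Q = Ext ℚP.+-*-commutativeRing

  natℚ-nonNegative : ∀ k → 0ℚ ℚ.≤ Q.natR k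
  natℚ-nonNegative zero    = ℚP.≤-refl
  natℚ-nonNegative (suc k) =
    subst (ℚ._≤ Q.natR (suc k)) (ℚP.+-identityˡ 0ℚ) (ℚP.+-mono-≤ (ℚP.nonNegative⁻¹ 1ℚ) (natℚ-nonNegative k))

  natℚ-suc≢0 : ∀ k → Q.natR (suc k) ≢ 0ℚ
  natℚ-suc≢0 k = ≡.≢-sym (ℚP.<⇒≢ (subst (ℚ._< Q.natR (suc k)) (ℚP.+-identityˡ 0ℚ)
                                   (ℚP.+-mono-<-≤ (ℚP.positive⁻¹ 1ℚ) (natℚ-nonNegative k))))

  fromℤ-ℚ-≢0 : ∀ {z} → z ≢ 0ℤ → Q.fromℤ z ≢ 0ℚ
  fromℤ-ℚ-≢0 {ℤ.+ zero}    z≢0 = λ _ → z≢0 ≡.refl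
  fromℤ-ℚ-≢0 {ℤ.+ suc k}   _   = natℚ-suc≢0 k
  fromℤ-ℚ-≢0 {ℤ.-[1+ k ]}  _   = natℚ-suc≢0 k ∘ ℚP.neg-injective

extensor-homogeneous : ∀ {n} {N : Subset n → ℤ} → IsExtensorℤ N → ∃ λ k → ∀ S → N S ≢ 0ℤ → ∣ S ∣ ≡ k
extensor-homogeneous {N = N} (inj₁ (a , N≈a𝟏)) =
  0 , λ S N[S]≢0 → decidable-stable (∣ S ∣ ℕP.≟ 0)
        (fromℤ-ℚ-≢0 N[S]≢0 ∘ ≡.trans (N≈a𝟏 S) ∘ Homogeneity.·𝟏-homogeneous ℚP.+-*-commutativeRing a S)
extensor-homogeneous {N = N} (inj₂ (vs , N≈∧vs)) =
  length vs , λ S N[S]≢0 → decidable-stable (∣ S ∣ ℕP.≟ length vs)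
        (fromℤ-ℚ-≢0 N[S]≢0 ∘ ≡.trans (N≈∧vs S) ∘ Homogeneity.wedgeAll-homogeneous ℚP.+-*-commutativeRing vs S)

-- The integer factor of the S-th summand of 𝐌_E(𝐍)[X_ι Y_υ]: the sign of the shuffle of
-- X_ι S with Y_υ (E∖S), times 𝐍[X S] and 𝐍^⊥[Y (E∖S)] = 𝐍[(P∖Y) S] ε((P∖Y) S Y (E∖S)).
𝐌E-coefficient : ∀ {p m} → (List (Fin (p ℕ.+ m)) → ℤ) → (Subset (p ℕ.+ m) → ℤ) →
                 Subset p → Subset p → Subset m → ℤ
𝐌E-coefficient ε N X Y S =
  sgnSeq (lst ((X ++ᵛ ⊥) ++ᵛ S) ++ lst ((⊥ ++ᵛ Y) ++ᵛ ∁ S))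
    ℤ.* (N (X ++ᵛ S) ℤ.* (N (∁ Y ++ᵛ S) ℤ.* ε (lst (∁ Y ++ᵛ S) ++ lst (Y ++ᵛ ∁ S))))

module Expansion {c ℓ : Level} (R : CommutativeRing c ℓ) (p m : ℕ) where

  open Ported p m
  open OverRing R
  open CommutativeRing R
  open Ext R
  open Arithmetic R
  open Exterior R
  open import Relation.Binary.Reasoning.Setoid setoid

  open CommutativeSemigroupProperties *-commutativeSemigroup using (interchange; x∙yz≈y∙xz)

  𝐌∅P-at : ∀ (εp : List (Fin p) → ℤ) (L : Subset p → ℤ) X Y →
           𝐌∅P εp L (X ++ᵛ Y) ≈ fromℤ (L X ℤ.* (L (∁ Y) ℤ.* εp (lst (∁ Y) ++ lst Y)))
  𝐌∅P-at εp L X Y = begin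
    𝐌∅P εp L (X ++ᵛ Y)
      ≡⟨ cong (plk (x ∧ y)) (≡.trans (ListP.++-identityʳ _) (ListP.map-id (lst (X ++ᵛ Y)))) ⟩
    plk (x ∧ y) (lst (X ++ᵛ Y))
      ≈⟨ plk-lst (x ∧ y) (X ++ᵛ Y) ⟩
    (x ∧ y) (X ++ᵛ Y)
      ≈⟨ ∧-relabel (↑ˡ-image p) (↑ʳ-image p) _ _ (toR L) (dual εp (toR L)) (X ++ᵛ Y) ⟩
    ΣL (allSubsets p) (λ A → ΣL (allSubsets p) (term A))
      ≈⟨ ΣL-collapse p X (λ A A≢X → ΣL-zero (allSubsets p) λ B →
           [no]-* (((A ++ᵛ ⊥) ∪ (⊥ ++ᵛ B)) ≟S (X ++ᵛ Y))
                  (A≢X ∘ VecP.++-injectiveˡ A X ∘ ≡.trans (≡.sym (++⊥-∪-⊥++ A B))) _) ⟩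
    ΣL (allSubsets p) (term X)
      ≈⟨ ΣL-collapse p Y (λ B B≢Y →
           [no]-* (((X ++ᵛ ⊥) ∪ (⊥ ++ᵛ B)) ≟S (X ++ᵛ Y))
                  (B≢Y ∘ VecP.++-injectiveʳ X X ∘ ≡.trans (≡.sym (++⊥-∪-⊥++ X B))) _) ⟩
    term X Y
      ≡⟨ cong₂ (λ i s → i * (fromℤ s * value)) ([yes] (((X ++ᵛ ⊥) ∪ (⊥ ++ᵛ Y)) ≟S (X ++ᵛ Y)) (++⊥-∪-⊥++ X Y))
               sign ⟩
    1# * (fromℤ 1ℤ * ((ΠL (lst X) one * fromℤ (L X)) * (ΠL (lst Y) one * dual εp (toR L) Y)))
      ≈⟨ trans (*-identityˡ _) (trans (*-congʳ fromℤ-1) (*-identityˡ _)) ⟩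
    (ΠL (lst X) one * fromℤ (L X)) * (ΠL (lst Y) one * dual εp (toR L) Y)
      ≈⟨ *-cong (trans (*-congʳ (ΠL-1 (lst X))) (*-identityˡ _))
                (trans (*-congʳ (ΠL-1 (lst Y))) (trans (*-identityˡ _) (dual-at εp L Y))) ⟩
    fromℤ (L X) * (fromℤ (L (∁ Y)) * fromℤ (εp (lst (∁ Y) ++ lst Y)))
      ≈⟨ trans (fromℤ-* (L X) _) (*-congˡ (fromℤ-* (L (∁ Y)) _)) ⟨
    fromℤ (L X ℤ.* (L (∁ Y) ℤ.* εp (lst (∁ Y) ++ lst Y))) ∎
    where
    one : Fin p → Carrier
    one _ = 1#
    x = relabel (_↑ˡ p) one (toR L)
    y = relabel (p ↑ʳ_) one (dual εp (toR L))
    term : Subset p → Subset p → Carrier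
    term A B = [ ((A ++ᵛ ⊥) ∪ (⊥ ++ᵛ B)) ≟S (X ++ᵛ Y) ]? * (fromℤ (sgnSeq (lst (A ++ᵛ ⊥) ++ lst (⊥ ++ᵛ B)))
                 * ((ΠL (lst A) one * fromℤ (L A)) * (ΠL (lst B) one * dual εp (toR L) B)))
    value = (ΠL (lst X) one * fromℤ (L X)) * (ΠL (lst Y) one * dual εp (toR L) Y)
    sign : sgnSeq (lst (X ++ᵛ ⊥ {p}) ++ lst (⊥ {p} ++ᵛ Y)) ≡ 1ℤ
    sign = ≡.trans (cong sgnSeq (≡.trans (cong₂ _++_ (lst-++⊥ p X) (lst-⊥++ p Y)) (≡.sym (lst-++ X Y))))
                   (sgnSeq-lst (X ++ᵛ Y))

  private
    ιmap-↑ˡ : ∀ i → ιmap (i ↑ˡ m) ≡ (i ↑ˡ p) ↑ˡ m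
    ιmap-↑ˡ i rewrite FinP.splitAt-↑ˡ p i m = ≡.refl

    ιmap-↑ʳ : ∀ e → ιmap (p ↑ʳ e) ≡ (p ℕ.+ p) ↑ʳ e
    ιmap-↑ʳ e rewrite FinP.splitAt-↑ʳ p m e = ≡.refl

    υmap-↑ˡ : ∀ i → υmap (i ↑ˡ m) ≡ (p ↑ʳ i) ↑ˡ m
    υmap-↑ˡ i rewrite FinP.splitAt-↑ˡ p i m = ≡.refl

    υmap-↑ʳ : ∀ e → υmap (p ↑ʳ e) ≡ (p ℕ.+ p) ↑ʳ e
    υmap-↑ʳ e rewrite FinP.splitAt-↑ʳ p m e = ≡.refl

    scal-↑ˡ : ∀ h i → scal h (i ↑ˡ m) ≈ 1#
    scal-↑ˡ h i rewrite FinP.splitAt-↑ˡ p i m = refl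

    scal-↑ʳ : ∀ h e → scal h (p ↑ʳ e) ≈ h e
    scal-↑ʳ h e rewrite FinP.splitAt-↑ʳ p m e = refl

  ι-image : SortedImage ιmap
  ι-image = blockwise-image (↑ˡ-image p) ιmap ιmap-↑ˡ ιmap-↑ʳ

  υ-image : SortedImage υmap
  υ-image = blockwise-image (↑ʳ-image p) υmap υmap-↑ˡ υmap-↑ʳ

  ΠL-scal : ∀ h X S → ΠL (lst (X ++ᵛ S)) (scal h) ≈ ΠL (lst S) h
  ΠL-scal h X S = begin
    ΠL (lst (X ++ᵛ S)) (scal h)
      ≡⟨ cong (λ xs → ΠL xs (scal h)) (lst-++ X S) ⟩
    ΠL (map (_↑ˡ m) (lst X) ++ map (p ↑ʳ_) (lst S)) (scal h)
      ≈⟨ ΠL-++ (map (_↑ˡ m) (lst X)) _ (scal h) ⟩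
    ΠL (map (_↑ˡ m) (lst X)) (scal h) * ΠL (map (p ↑ʳ_) (lst S)) (scal h)
      ≡⟨ cong₂ _*_ (ΠL-map (_↑ˡ m) (lst X) (scal h)) (ΠL-map (p ↑ʳ_) (lst S) (scal h)) ⟩
    ΠL (lst X) (scal h ∘ (_↑ˡ m)) * ΠL (lst S) (scal h ∘ (p ↑ʳ_))
      ≈⟨ *-cong (trans (ΠL-cong (lst X) (scal-↑ˡ h)) (ΠL-1 (lst X))) (ΠL-cong (lst S) (scal-↑ʳ h)) ⟩
    1# * ΠL (lst S) h
      ≈⟨ *-identityˡ _ ⟩
    ΠL (lst S) h ∎

  module _ (ε : List (Fin (p ℕ.+ m)) → ℤ) (g r : Fin m → Carrier) (N : Subset (p ℕ.+ m) → ℤ) (X Y : Subset p) where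

    private
      C′ : Subset ((p ℕ.+ p) ℕ.+ m)
      C′ = (X ++ᵛ Y) ++ᵛ ⊤

      term : (A′ B′ : Subset ((p ℕ.+ p) ℕ.+ m)) (A B : Subset (p ℕ.+ m)) → Carrier
      term A′ B′ A B = [ (A′ ∪ B′) ≟S C′ ]? * (fromℤ (sgnSeq (lst A′ ++ lst B′))
                         * ((ΠL (lst A) (scal g) * fromℤ (N A)) * (ΠL (lst B) (scal r) * dual ε (toR N) B)))

      block-term : Subset p → Subset m → Subset p → Subset m → Carrier
      block-term X′ S Y′ S′ = term ((X′ ++ᵛ ⊥ {p}) ++ᵛ S) ((⊥ {p} ++ᵛ Y′) ++ᵛ S′) (X′ ++ᵛ S) (Y′ ++ᵛ S′)

      ∪-blocks : ∀ (X′ : Subset p) (S : Subset m) Y′ S′ →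
                 ((X′ ++ᵛ ⊥ {p}) ++ᵛ S) ∪ ((⊥ {p} ++ᵛ Y′) ++ᵛ S′) ≡ (X′ ++ᵛ Y′) ++ᵛ (S ∪ S′)
      ∪-blocks X′ S Y′ S′ =
        ≡.trans (∪-++ (X′ ++ᵛ ⊥ {p}) (⊥ {p} ++ᵛ Y′) S S′) (cong (_++ᵛ (S ∪ S′)) (++⊥-∪-⊥++ X′ Y′))

      block-term-off : ∀ X′ S Y′ S′ → (X′ ++ᵛ Y′) ++ᵛ (S ∪ S′) ≢ C′ → block-term X′ S Y′ S′ ≈ 0#
      block-term-off X′ S Y′ S′ ≢C′ =
        [no]-* ((((X′ ++ᵛ ⊥ {p}) ++ᵛ S) ∪ ((⊥ {p} ++ᵛ Y′) ++ᵛ S′)) ≟S C′)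
               (≢C′ ∘ ≡.trans (≡.sym (∪-blocks X′ S Y′ S′))) _

      overlapping-term-off : ∀ S S′ → S′ ≢ ∁ S → block-term X S Y S′ ≈ 0#
      overlapping-term-off S S′ S′≢∁S with (S ∪ S′) ≟S ⊤
      ... | no S∪S′≢⊤ = block-term-off X S Y S′ (S∪S′≢⊤ ∘ VecP.++-injectiveʳ (X ++ᵛ Y) (X ++ᵛ Y))
      ... | yes S∪S′≡⊤ with ∪≡⊤⇒meet S S′ S∪S′≡⊤ S′≢∁S
      ...   | e , e∈S , e∈S′ =
        trans (*-congˡ (trans (*-congʳ (≡⇒≈ (cong fromℤ (sgnSeq-nonunique
                (nonunique-++-∈ (∈-E-block {X ++ᵛ ⊥ {p}} e∈S) (∈-E-block {⊥ {p} ++ᵛ Y} e∈S′)))))) (zeroˡ _))) (zeroʳ _)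
        where
        ∈-E-block : ∀ {Z : Subset (p ℕ.+ p)} {T} → e Subset.∈ T → (p ℕ.+ p) ↑ʳ e ∈ lst (Z ++ᵛ T)
        ∈-E-block {Z} e∈T = subst ((p ℕ.+ p) ↑ʳ e ∈_) (≡.sym (lst-++ Z _))
                              (∈P.∈-++⁺ʳ (map (_↑ˡ m) (lst Z)) (∈P.∈-map⁺ ((p ℕ.+ p) ↑ʳ_) (∈-lst e∈T)))

      diagonal-term : ∀ S → block-term X S Y (∁ S) ≈ (ΠL (lst S) g * ΠL (lst (∁ S)) r) * fromℤ (𝐌E-coefficient ε N X Y S)
      diagonal-term S = begin
        block-term X S Y (∁ S)
          ≡⟨ cong (_* (fromℤ σ * ((Gₛ * fromℤ n₁) * (Hₛ * D)))) ([yes] (_ ≟S C′) covers) ⟩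
        1# * (fromℤ σ * ((Gₛ * fromℤ n₁) * (Hₛ * D)))
          ≈⟨ *-identityˡ _ ⟩
        fromℤ σ * ((Gₛ * fromℤ n₁) * (Hₛ * D))
          ≈⟨ *-congˡ (*-cong (*-congʳ (ΠL-scal g X S)) (*-cong (ΠL-scal r Y (∁ S)) D-at)) ⟩
        fromℤ σ * ((G * fromℤ n₁) * (H * (fromℤ n₂ * fromℤ e)))
          ≈⟨ *-congˡ (interchange G (fromℤ n₁) H _) ⟩
        fromℤ σ * ((G * H) * (fromℤ n₁ * (fromℤ n₂ * fromℤ e)))
          ≈⟨ x∙yz≈y∙xz (fromℤ σ) (G * H) _ ⟩
        (G * H) * (fromℤ σ * (fromℤ n₁ * (fromℤ n₂ * fromℤ e)))
          ≈⟨ *-congˡ (trans (fromℤ-* σ _) (*-congˡ (trans (fromℤ-* n₁ _) (*-congˡ (fromℤ-* n₂ e))))) ⟨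
        (G * H) * fromℤ (𝐌E-coefficient ε N X Y S) ∎
        where
        σ  = sgnSeq (lst ((X ++ᵛ ⊥ {p}) ++ᵛ S) ++ lst ((⊥ {p} ++ᵛ Y) ++ᵛ ∁ S))
        n₁ = N (X ++ᵛ S)
        n₂ = N (∁ Y ++ᵛ S)
        e  = ε (lst (∁ Y ++ᵛ S) ++ lst (Y ++ᵛ ∁ S))
        G  = ΠL (lst S) g
        H  = ΠL (lst (∁ S)) r
        Gₛ = ΠL (lst (X ++ᵛ S)) (scal g)
        Hₛ = ΠL (lst (Y ++ᵛ ∁ S)) (scal r)
        D  = dual ε (toR N) (Y ++ᵛ ∁ S)

        covers : ((X ++ᵛ ⊥ {p}) ++ᵛ S) ∪ ((⊥ {p} ++ᵛ Y) ++ᵛ ∁ S) ≡ C′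
        covers = ≡.trans (∪-blocks X S Y (∁ S)) (cong ((X ++ᵛ Y) ++ᵛ_) (SubsetP.p∪∁p≡⊤ S))

        D-at : D ≈ fromℤ n₂ * fromℤ e
        D-at = trans (dual-at ε N (Y ++ᵛ ∁ S))
          (≡⇒≈ (cong (λ T → fromℤ (N T) * fromℤ (ε (lst T ++ lst (Y ++ᵛ ∁ S))))
                     (≡.trans (VecP.map-++ not Y (∁ S)) (cong (∁ Y ++ᵛ_) (∁-involutive S)))))

    𝐌E-at : 𝐌E ε g r N (X ++ᵛ Y) ≈
            ΣL (allSubsets m) (λ S → (ΠL (lst S) g * ΠL (lst (∁ S)) r) * fromℤ (𝐌E-coefficient ε N X Y S))
    𝐌E-at = begin
      𝐌E ε g r N (X ++ᵛ Y)
        ≡⟨ cong (plk (𝐌 ε g r N)) contraction-list ⟩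
      plk (𝐌 ε g r N) (lst C′)
        ≈⟨ plk-lst (𝐌 ε g r N) C′ ⟩
      𝐌 ε g r N C′
        ≈⟨ ∧-relabel ι-image υ-image (scal g) (scal r) (toR N) (dual ε (toR N)) C′ ⟩
      ΣL Aₚₘ (λ A → ΣL Aₚₘ (λ B → term (image ι-image A) (image υ-image B) A B))
        ≈⟨ split-blocks ⟩
      ΣL Aₚ (λ X′ → ΣL Aₘ (λ S → ΣL Aₚ (λ Y′ → ΣL Aₘ (λ S′ → block-term X′ S Y′ S′))))
        ≈⟨ ΣL-collapse p X (λ X′ X′≢X → ΣL-zero Aₘ λ S → ΣL-zero Aₚ λ Y′ → ΣL-zero Aₘ λ S′ →
             block-term-off X′ S Y′ S′ λ eq →
               X′≢X (VecP.++-injectiveˡ X′ X (VecP.++-injectiveˡ (X′ ++ᵛ Y′) (X ++ᵛ Y) eq))) ⟩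
      ΣL Aₘ (λ S → ΣL Aₚ (λ Y′ → ΣL Aₘ (λ S′ → block-term X S Y′ S′)))
        ≈⟨ ΣL-cong Aₘ (λ S → ΣL-collapse p Y (λ Y′ Y′≢Y → ΣL-zero Aₘ λ S′ →
             block-term-off X S Y′ S′ λ eq →
               Y′≢Y (VecP.++-injectiveʳ X X (VecP.++-injectiveˡ (X ++ᵛ Y′) (X ++ᵛ Y) eq)))) ⟩
      ΣL Aₘ (λ S → ΣL Aₘ (λ S′ → block-term X S Y S′))
        ≈⟨ ΣL-cong Aₘ (λ S → ΣL-collapse m (∁ S) (overlapping-term-off S)) ⟩
      ΣL Aₘ (λ S → block-term X S Y (∁ S))
        ≈⟨ ΣL-cong Aₘ diagonal-term ⟩
      ΣL Aₘ (λ S → (ΠL (lst S) g * ΠL (lst (∁ S)) r) * fromℤ (𝐌E-coefficient ε N X Y S)) ∎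
      where
      open SortedImage using (image)
      Aₚ = allSubsets p
      Aₘ = allSubsets m
      Aₚₘ = allSubsets (p ℕ.+ m)

      contraction-list : map (_↑ˡ m) (lst (X ++ᵛ Y)) ++ map Em (allFin m) ≡ lst C′
      contraction-list = ≡.sym (≡.trans (lst-++ (X ++ᵛ Y) ⊤)
                                        (cong (λ es → map (_↑ˡ m) (lst (X ++ᵛ Y)) ++ map ((p ℕ.+ p) ↑ʳ_) es) (lst-⊤ m)))

      split-blocks : ΣL Aₚₘ (λ A → ΣL Aₚₘ (λ B → term (image ι-image A) (image υ-image B) A B))
                   ≈ ΣL Aₚ (λ X′ → ΣL Aₘ (λ S → ΣL Aₚ (λ Y′ → ΣL Aₘ (λ S′ → block-term X′ S Y′ S′))))
      split-blocks = trans (ΣL-split p m _) (ΣL-cong Aₚ λ X′ → ΣL-cong Aₘ λ S → trans (ΣL-split p m _)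
        (ΣL-cong Aₚ λ Y′ → ΣL-cong Aₘ λ S′ → ≡⇒≈ (cong₂ (λ A′ B′ → term A′ B′ (X′ ++ᵛ S) (Y′ ++ᵛ S′))
          (blockwise-image-++ (↑ˡ-image p) ιmap ιmap-↑ˡ ιmap-↑ʳ X′ S)
          (blockwise-image-++ (↑ʳ-image p) υmap υmap-↑ˡ υmap-↑ʳ Y′ S′))))

-- The sign identity

*-sign-swap : ∀ {a b s} → s ℤ.* s ≡ 1ℤ → a ℤ.* s ≡ b → a ≡ b ℤ.* s
*-sign-swap {a} {b} {s} s²≡1 as≡b = begin
  a                   ≡⟨ ℤP.*-identityʳ a ⟨
  a ℤ.* 1ℤ            ≡⟨ cong (a ℤ.*_) s²≡1 ⟨
  a ℤ.* (s ℤ.* s)     ≡⟨ ℤP.*-assoc a s s ⟨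
  a ℤ.* s ℤ.* s       ≡⟨ cong (ℤ._* s) as≡b ⟩
  b ℤ.* s             ∎
  where open ≡.≡-Reasoning

module _ (p m : ℕ) (ε : List (Fin (p ℕ.+ m)) → ℤ) (ε-orientation : GroundSetOrientation ε) where

  open ≡.≡-Reasoning

  open Ported p m

  private
    ε-values : ∀ xs → ε xs ≡ 1ℤ ⊎ ε xs ≡ -1ℤ ⊎ ε xs ≡ 0ℤ
    ε-values = proj₁ ε-orientation

    ε-alt : Alternating ε
    ε-alt = proj₁ (proj₂ ε-orientation)

    ε-nonzero : ∀ xs → Unique xs → ε xs ≢ 0ℤ
    ε-nonzero = proj₁ (proj₂ (proj₂ ε-orientation))

  ε-Pseq-sign : IsSign (ε Pseq)
  ε-Pseq-sign with ε-values Pseq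
  ... | inj₁ ε≡1         = inj₁ ε≡1
  ... | inj₂ (inj₁ ε≡-1) = inj₂ ε≡-1
  ... | inj₂ (inj₂ ε≡0)  =
    contradiction ε≡0 (ε-nonzero Pseq (UniqueP.map⁺ (FinP.↑ˡ-injective m _ _) (UniqueP.allFin⁺ p)))

  𝐌E-sign : ∀ (X Y : Subset p) (S : Subset m) →
    sgnSeq (lst ((X ++ᵛ ⊥ {p}) ++ᵛ S) ++ lst ((⊥ {p} ++ᵛ Y) ++ᵛ ∁ S)) ℤ.* ε (lst (∁ Y ++ᵛ S) ++ lst (Y ++ᵛ ∁ S))
      ≡ ε Pseq ℤ.* (ε (Pseq ++ Eseq) ℤ.* εP ε (lst (∁ Y) ++ lst Y))
  𝐌E-sign X Y S = begin
    sgnSeq (lst ((X ++ᵛ ⊥) ++ᵛ S) ++ lst ((⊥ ++ᵛ Y) ++ᵛ ∁ S)) ℤ.* ε (lst (∁ Y ++ᵛ S) ++ lst (Y ++ᵛ ∁ S))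
      ≡⟨ cong₂ ℤ._*_ sgnSeq-blocks ε-blocks ⟩
    (ν ℤ.* sgnSeq zs) ℤ.* (ν ℤ.* φ)
      ≡⟨ ℤ*.interchange ν (sgnSeq zs) ν φ ⟩
    (ν ℤ.* ν) ℤ.* (sgnSeq zs ℤ.* φ)
      ≡⟨ cong₂ ℤ._*_ (sign-square (negOnePow-sign (length (lst Y) ℕ.* length (lst S)))) (ℤP.*-comm (sgnSeq zs) φ) ⟩
    1ℤ ℤ.* (φ ℤ.* sgnSeq zs)
      ≡⟨ ℤP.*-identityˡ _ ⟩
    φ ℤ.* sgnSeq zs
      ≡⟨ sort-E ⟩
    ε (map ιP ys ++ Eseq)
      ≡⟨ *-sign-swap ys-square sort-PE ⟩
    ε (Pseq ++ Eseq) ℤ.* sgnSeq ys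
      ≡⟨ cong (ℤ._* sgnSeq ys) (ℤP.*-identityˡ (ε (Pseq ++ Eseq))) ⟨
    1ℤ ℤ.* ε (Pseq ++ Eseq) ℤ.* sgnSeq ys
      ≡⟨ cong (λ z → z ℤ.* ε (Pseq ++ Eseq) ℤ.* sgnSeq ys) (sign-square ε-Pseq-sign) ⟨
    ε Pseq ℤ.* ε Pseq ℤ.* ε (Pseq ++ Eseq) ℤ.* sgnSeq ys
      ≡⟨ reassociate (ε Pseq) (ε (Pseq ++ Eseq)) (sgnSeq ys) ⟩
    ε Pseq ℤ.* (ε (Pseq ++ Eseq) ℤ.* (ε Pseq ℤ.* sgnSeq ys))
      ≡⟨ cong (λ z → ε Pseq ℤ.* (ε (Pseq ++ Eseq) ℤ.* z)) (*-sign-swap ys-square sort-P) ⟨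
    ε Pseq ℤ.* (ε (Pseq ++ Eseq) ℤ.* εP ε ys) ∎
    where
    ys = lst (∁ Y) ++ lst Y
    zs = lst S ++ lst (∁ S)
    ν  = negOnePow (length (lst Y) ℕ.* length (lst S))
    φ  = ε (map ιP ys ++ map ιE zs)

    ys↭P : ys ↭ lst (⊤ {p})
    ys↭P = ↭-trans (PermP.++-comm (lst (∁ Y)) (lst Y)) (lst-∁-↭ Y)

    ys-square : sgnSeq ys ℤ.* sgnSeq ys ≡ 1ℤ
    ys-square = ≡.trans (alternating-↭ sgnSeq sgnSeq-alternating sgnSeq sgnSeq-alternating ys↭P)
                        (cong (λ z → z ℤ.* z) (sgnSeq-lst (⊤ {p})))

    sort-E : φ ℤ.* sgnSeq zs ≡ ε (map ιP ys ++ Eseq)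
    sort-E = begin
      φ ℤ.* sgnSeq zs
        ≡⟨ cong (λ es → ε (map ιP ys ++ es) ℤ.* sgnSeq zs) (ListP.++-identityʳ (map ιE zs)) ⟨
      ε (map ιP ys ++ map ιE zs ++ []) ℤ.* sgnSeq zs
        ≡⟨ alternating-sort ε ε-alt (map ιP ys) ιE [] ⊤ (lst-∁-↭ S) ⟩
      ε (map ιP ys ++ map ιE (lst (⊤ {m})) ++ [])
        ≡⟨ cong (λ es → ε (map ιP ys ++ es)) (≡.trans (ListP.++-identityʳ (map ιE (lst ⊤))) (cong (map ιE) (lst-⊤ m))) ⟩
      ε (map ιP ys ++ Eseq) ∎

    sort-PE : ε (map ιP ys ++ Eseq) ℤ.* sgnSeq ys ≡ ε (Pseq ++ Eseq)
    sort-PE = ≡.trans (alternating-sort ε ε-alt [] ιP Eseq ⊤ ys↭P)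
                      (cong (λ ps → ε (map ιP ps ++ Eseq)) (lst-⊤ p))

    sort-P : εP ε ys ℤ.* sgnSeq ys ≡ ε Pseq
    sort-P = begin
      ε (map ιP ys) ℤ.* sgnSeq ys
        ≡⟨ cong (λ ps → ε ps ℤ.* sgnSeq ys) (ListP.++-identityʳ (map ιP ys)) ⟨
      ε (map ιP ys ++ []) ℤ.* sgnSeq ys
        ≡⟨ alternating-sort ε ε-alt [] ιP [] ⊤ ys↭P ⟩
      ε (map ιP (lst ⊤) ++ [])
        ≡⟨ cong ε (≡.trans (ListP.++-identityʳ (map ιP (lst ⊤))) (cong (map ιP) (lst-⊤ p))) ⟩
      ε Pseq ∎

    reassociate : ∀ a b c → a ℤ.* a ℤ.* b ℤ.* c ≡ a ℤ.* (b ℤ.* (a ℤ.* c))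
    reassociate a b c = begin
      a ℤ.* a ℤ.* b ℤ.* c        ≡⟨ ℤP.*-assoc (a ℤ.* a) b c ⟩
      a ℤ.* a ℤ.* (b ℤ.* c)      ≡⟨ ℤP.*-assoc a a _ ⟩
      a ℤ.* (a ℤ.* (b ℤ.* c))    ≡⟨ cong (a ℤ.*_) (ℤ*.x∙yz≈y∙xz a b c) ⟩
      a ℤ.* (b ℤ.* (a ℤ.* c))    ∎

    sgnSeq-blocks : sgnSeq (lst ((X ++ᵛ ⊥) ++ᵛ S) ++ lst ((⊥ ++ᵛ Y) ++ᵛ ∁ S)) ≡ ν ℤ.* sgnSeq zs
    sgnSeq-blocks = begin
      sgnSeq (lst ((X ++ᵛ ⊥) ++ᵛ S) ++ lst ((⊥ ++ᵛ Y) ++ᵛ ∁ S))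
        ≡⟨ cong₂ (λ as bs → sgnSeq (as ++ bs)) (lst-++ (X ++ᵛ ⊥) S) (lst-++ (⊥ ++ᵛ Y) (∁ S)) ⟩
      sgnSeq ((a₁ ++ a₂) ++ (b₁ ++ b₂))
        ≡⟨ alternating-interchange sgnSeq sgnSeq-alternating a₁ a₂ b₁ b₂ ⟩
      negOnePow (length b₁ ℕ.* length a₂) ℤ.* sgnSeq ((a₁ ++ b₁) ++ (a₂ ++ b₂))
        ≡⟨ cong₂ ℤ._*_ (cong negOnePow (cong₂ ℕ._*_ length-b₁ (ListP.length-map _ (lst S)))) sorted ⟩
      ν ℤ.* sgnSeq zs ∎
      where
      a₁ = map (_↑ˡ m) (lst (X ++ᵛ ⊥ {p}))
      a₂ = map ((p ℕ.+ p) ↑ʳ_) (lst S)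
      b₁ = map (_↑ˡ m) (lst (⊥ {p} ++ᵛ Y))
      b₂ = map ((p ℕ.+ p) ↑ʳ_) (lst (∁ S))

      length-b₁ : length b₁ ≡ length (lst Y)
      length-b₁ = ≡.trans (ListP.length-map _ (lst (⊥ {p} ++ᵛ Y)))
                          (≡.trans (cong length (lst-⊥++ p Y)) (ListP.length-map _ (lst Y)))

      sorted : sgnSeq ((a₁ ++ b₁) ++ (a₂ ++ b₂)) ≡ sgnSeq zs
      sorted = begin
        sgnSeq ((a₁ ++ b₁) ++ (a₂ ++ b₂))
          ≡⟨ cong₂ (λ as bs → sgnSeq (as ++ bs)) (ListP.map-++ (_↑ˡ m) (lst (X ++ᵛ ⊥)) _) (ListP.map-++ _ (lst S) _) ⟨
        sgnSeq (map (_↑ˡ m) (lst (X ++ᵛ ⊥) ++ lst (⊥ ++ᵛ Y)) ++ map ((p ℕ.+ p) ↑ʳ_) zs)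
          ≡⟨ sgnSeq-↑ (lst (X ++ᵛ ⊥) ++ lst (⊥ ++ᵛ Y)) zs ⟩
        sgnSeq (lst (X ++ᵛ ⊥) ++ lst (⊥ ++ᵛ Y)) ℤ.* sgnSeq zs
          ≡⟨ cong (λ xs → sgnSeq xs ℤ.* sgnSeq zs)
                  (≡.trans (cong₂ _++_ (lst-++⊥ p X) (lst-⊥++ p Y)) (≡.sym (lst-++ X Y))) ⟩
        sgnSeq (lst (X ++ᵛ Y)) ℤ.* sgnSeq zs
          ≡⟨ cong (ℤ._* sgnSeq zs) (sgnSeq-lst (X ++ᵛ Y)) ⟩
        1ℤ ℤ.* sgnSeq zs
          ≡⟨ ℤP.*-identityˡ _ ⟩
        sgnSeq zs ∎

    ε-blocks : ε (lst (∁ Y ++ᵛ S) ++ lst (Y ++ᵛ ∁ S)) ≡ ν ℤ.* φ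
    ε-blocks = begin
      ε (lst (∁ Y ++ᵛ S) ++ lst (Y ++ᵛ ∁ S))
        ≡⟨ cong₂ (λ as bs → ε (as ++ bs)) (lst-++ (∁ Y) S) (lst-++ Y (∁ S)) ⟩
      ε ((map ιP (lst (∁ Y)) ++ map ιE (lst S)) ++ (map ιP (lst Y) ++ map ιE (lst (∁ S))))
        ≡⟨ alternating-interchange ε ε-alt (map ιP (lst (∁ Y))) (map ιE (lst S)) (map ιP (lst Y)) (map ιE (lst (∁ S))) ⟩
      negOnePow (length (map ιP (lst Y)) ℕ.* length (map ιE (lst S)))
        ℤ.* ε ((map ιP (lst (∁ Y)) ++ map ιP (lst Y)) ++ (map ιE (lst S) ++ map ιE (lst (∁ S))))
        ≡⟨ cong₂ ℤ._*_ (cong negOnePow (cong₂ ℕ._*_ (ListP.length-map ιP (lst Y)) (ListP.length-map ιE (lst S))))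
                       (cong₂ (λ ps es → ε (ps ++ es)) (≡.sym (ListP.map-++ ιP (lst (∁ Y)) _))
                                                     (≡.sym (ListP.map-++ ιE (lst S) _))) ⟩
      ν ℤ.* φ ∎

-- Minors at a basis

sgnℤ-unimodular : ∀ {z} → z ≡ 0ℤ ⊎ z ≡ 1ℤ ⊎ z ≡ -1ℤ → sgnℤ z ≡ z
sgnℤ-unimodular (inj₁ ≡.refl)        = ≡.refl
sgnℤ-unimodular (inj₂ (inj₁ ≡.refl)) = ≡.refl
sgnℤ-unimodular (inj₂ (inj₂ ≡.refl)) = ≡.refl

module Minor (p m : ℕ) (N : Subset (p ℕ.+ m) → ℤ) where

  open Ported p m
  open ≡.≡-Reasoning

  uExponent vExponent : Subset m → ℕ
  uExponent S = (rank N ⊤ ∸ minorRank N S) ∸ rank N (Eimg S)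
  vExponent S = ∣ S ∣ ∸ rank N (Eimg S)

  Eimg-≡ : ∀ S → Eimg S ≡ ⊥ {p} ++ᵛ S
  Eimg-≡ S = ≡.trans (cong setOf (≡.sym (lst-⊥++ p S))) (setOf-lst (⊥ ++ᵛ S))

  Eimg-∪-Pset : ∀ S → Eimg S ∪ Pset ≡ ⊤ {p} ++ᵛ S
  Eimg-∪-Pset S = begin
    Eimg S ∪ Pset
      ≡⟨ cong₂ _∪_ (Eimg-≡ S) (≡.trans (cong (setOf ∘ map ιP) (≡.sym (lst-⊤ p)))
                                          (≡.trans (cong setOf (≡.sym (lst-++⊥ m (⊤ {p})))) (setOf-lst (⊤ {p} ++ᵛ ⊥ {m})))) ⟩
    (⊥ {p} ++ᵛ S) ∪ (⊤ {p} ++ᵛ ⊥)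
      ≡⟨ ∪-++ (⊥ {p}) ⊤ S ⊥ ⟩
    (⊥ ∪ ⊤) ++ᵛ (S ∪ ⊥)
      ≡⟨ cong₂ _++ᵛ_ (SubsetP.∪-identityˡ ⊤) (SubsetP.∪-identityʳ S) ⟩
    ⊤ ++ᵛ S ∎

  private
    rank-E≤rank-E∪P : ∀ S → rank N (Eimg S) ≤ rank N (Eimg S ∪ Pset)
    rank-E≤rank-E∪P S = rank-mono N (SubsetP.p⊆p∪q Pset)

  basis⇒exponents-vanish : IsExtensorℤ N → ∀ X S → N (X ++ᵛ S) ≢ 0ℤ → uExponent S ≡ 0 × vExponent S ≡ 0
  basis⇒exponents-vanish N-extensor X S N[X++S]≢0 =
    ℕP.m≤n⇒m∸n≡0 (ℕP.≤-trans (ℕP.∸-monoˡ-≤ (b ∸ c) a≤b)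
                             (ℕP.≤-reflexive (ℕP.m∸[m∸n]≡n (rank-E≤rank-E∪P S)))) ,
    ℕP.m≤n⇒m∸n≡0 (subst (_≤ c) (∣⊥++p∣≡∣p∣ {p} S)
      (independent-≤-rank N (Eimg S) (subst ((⊥ ++ᵛ S) ⊆_) (≡.sym (Eimg-≡ S)) (λ x∈ → x∈))
                          (independent (++-mono-⊆ {p} {m} SubsetP.⊥⊆ (λ x∈ → x∈)))))
    where
    a = rank N ⊤
    b = rank N (Eimg S ∪ Pset)
    c = rank N (Eimg S)
    independent : ∀ {I} → I ⊆ X ++ᵛ S → isIndep N I ≡ true
    independent I⊆ = independent-⊆-basis N I⊆ N[X++S]≢0
    a≤b : a ≤ b
    a≤b with extensor-homogeneous N-extensor
    ... | k , basis-size = ℕP.≤-trans (rank-≤-basis-size N basis-size ⊤)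
      (subst (_≤ b) (basis-size (X ++ᵛ S) N[X++S]≢0)
        (independent-≤-rank N (Eimg S ∪ Pset)
          (subst (X ++ᵛ S ⊆_) (≡.sym (Eimg-∪-Pset S)) (++-mono-⊆ {p} {m} SubsetP.⊆⊤ (λ x∈ → x∈)))
          (independent (λ x∈ → x∈))))

  exponents-vanish⇒presentation :
    Unimodular N → ∀ S {L} → Unimodular L → PresentsMinor N S L → uExponent S ≡ 0 → vExponent S ≡ 0 →
    Σ ℤ λ σ → IsSign σ × (∀ B → L B ≡ σ ℤ.* N (B ++ᵛ S))
  exponents-vanish⇒presentation N-unimodular S {L} L-unimodular
    (I , J , σ , I⊆E , rank-I≡∣I∣ , rank-I≡rank-E , _ , _ , ∣J∣+b≡a , σ-sign , L-chirotope) u≡0 v≡0 =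
    σ , σ-sign , λ B → begin
      L B                                                      ≡⟨ sgnℤ-unimodular (L-unimodular B) ⟨
      sgnℤ (L B)                                               ≡⟨ L-chirotope B ⟩
      σ ℤ.* sgnℤ (plkℤ N (map ιP (lst B) ++ lst J ++ lst I))   ≡⟨ cong (λ z → σ ℤ.* sgnℤ z) (minor-basis B) ⟩
      σ ℤ.* sgnℤ (N (B ++ᵛ S))                                 ≡⟨ cong (σ ℤ.*_) (sgnℤ-unimodular (N-unimodular _)) ⟩
      σ ℤ.* N (B ++ᵛ S)                                        ∎
    where
    a = rank N ⊤
    b = rank N (Eimg S ∪ Pset)
    c = rank N (Eimg S)

    I≡E : I ≡ Eimg S
    I≡E = p⊆q⇒∣q∣≤∣p∣⇒p≡q I⊆E
      (subst (_≤ ∣ I ∣) (≡.sym (≡.trans (cong ∣_∣ (Eimg-≡ S)) (∣⊥++p∣≡∣p∣ {p} S)))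
            (ℕP.≤-trans (ℕP.m∸n≡0⇒m≤n v≡0) (ℕP.≤-reflexive (≡.trans (≡.sym rank-I≡rank-E) rank-I≡∣I∣))))

    a≤b : a ≤ b
    a≤b = ℕP.≤-trans (ℕP.m≤n+m∸n a (b ∸ c))
            (ℕP.≤-trans (ℕP.+-monoʳ-≤ (b ∸ c) (ℕP.m∸n≡0⇒m≤n u≡0))
                        (ℕP.≤-reflexive (ℕP.m∸n+n≡m (rank-E≤rank-E∪P S))))

    J≡⊥ : J ≡ ⊥
    J≡⊥ = ≡.sym (p⊆q⇒∣q∣≤∣p∣⇒p≡q SubsetP.⊥⊆
      (ℕP.≤-trans (ℕP.+-cancelʳ-≤ b ∣ J ∣ 0 (subst (_≤ b) (≡.sym ∣J∣+b≡a) a≤b)) ℕ.z≤n))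

    minor-basis : ∀ B → plkℤ N (map ιP (lst B) ++ lst J ++ lst I) ≡ N (B ++ᵛ S)
    minor-basis B = begin
      plkℤ N (map ιP (lst B) ++ lst J ++ lst I)
        ≡⟨ cong₂ (λ J′ I′ → plkℤ N (map ιP (lst B) ++ lst J′ ++ lst I′)) J≡⊥ (≡.trans I≡E (Eimg-≡ S)) ⟩
      plkℤ N (map ιP (lst B) ++ lst (⊥ {p ℕ.+ m}) ++ lst (⊥ {p} ++ᵛ S))
        ≡⟨ cong (λ es → plkℤ N (map ιP (lst B) ++ es)) (cong₂ _++_ (lst-⊥ (p ℕ.+ m)) (lst-⊥++ p S)) ⟩
      plkℤ N (map ιP (lst B) ++ map ιE (lst S))
        ≡⟨ cong (plkℤ N) (lst-++ B S) ⟨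
      plkℤ N (lst (B ++ᵛ S))
        ≡⟨ cong₂ ℤ._*_ (sgnSeq-lst (B ++ᵛ S)) (cong N (setOf-lst (B ++ᵛ S))) ⟩
      1ℤ ℤ.* N (B ++ᵛ S)
        ≡⟨ ℤP.*-identityˡ _ ⟩
      N (B ++ᵛ S) ∎

module Coefficient (p m : ℕ) (ε : List (Fin (p ℕ.+ m)) → ℤ) (ε-orientation : GroundSetOrientation ε)
                   (N : Subset (p ℕ.+ m) → ℤ) (N-unimodular : UnimodularExtensor N)
                   (L : Subset m → Subset p → ℤ) (L-minors : ∀ A → UnimodularExtensor (L A) × Ported.PresentsMinor p m N A (L A))
                   (X Y : Subset p) where

  open Ported p m
  open Minor p m N
  open import Algebra.Solver.CommutativeMonoid ℤP.*-1-commutativeMonoid using (solve; _⊜_) renaming (_⊕_ to _⊛_)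

  minor-term : Subset m → ℤ
  minor-term S = L S X ℤ.* (L S (∁ Y) ℤ.* εP ε (lst (∁ Y) ++ lst Y))

  coefficient-nondegenerate : ∀ S → uExponent S ≡ 0 → vExponent S ≡ 0 →
    𝐌E-coefficient ε N X Y S ≡ ε Pseq ℤ.* (ε (Pseq ++ Eseq) ℤ.* minor-term S)
  coefficient-nondegenerate S u≡0 v≡0
    with exponents-vanish⇒presentation (proj₁ (proj₂ N-unimodular)) S (proj₁ (proj₂ (proj₁ (L-minors S))))
                                       (proj₂ (L-minors S)) u≡0 v≡0
  ... | σ , σ-sign , L≡σN = begin
    s ℤ.* (n₁ ℤ.* (n₂ ℤ.* e))
      ≡⟨ solve 4 (λ s n₁ n₂ e → s ⊛ (n₁ ⊛ (n₂ ⊛ e)) ⊜ (s ⊛ e) ⊛ (n₁ ⊛ n₂)) ≡.refl s n₁ n₂ e ⟩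
    (s ℤ.* e) ℤ.* (n₁ ℤ.* n₂)
      ≡⟨ cong (ℤ._* (n₁ ℤ.* n₂)) (𝐌E-sign p m ε ε-orientation X Y S) ⟩
    (εₚ ℤ.* (εₚₑ ℤ.* e′)) ℤ.* (n₁ ℤ.* n₂)
      ≡⟨ ℤP.*-identityˡ _ ⟨
    1ℤ ℤ.* ((εₚ ℤ.* (εₚₑ ℤ.* e′)) ℤ.* (n₁ ℤ.* n₂))
      ≡⟨ cong (ℤ._* ((εₚ ℤ.* (εₚₑ ℤ.* e′)) ℤ.* (n₁ ℤ.* n₂))) (sign-square σ-sign) ⟨
    (σ ℤ.* σ) ℤ.* ((εₚ ℤ.* (εₚₑ ℤ.* e′)) ℤ.* (n₁ ℤ.* n₂))
      ≡⟨ solve 6 (λ σ εₚ εₚₑ e′ n₁ n₂ → (σ ⊛ σ) ⊛ ((εₚ ⊛ (εₚₑ ⊛ e′)) ⊛ (n₁ ⊛ n₂))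
                                        ⊜ εₚ ⊛ (εₚₑ ⊛ ((σ ⊛ n₁) ⊛ ((σ ⊛ n₂) ⊛ e′)))) ≡.refl σ εₚ εₚₑ e′ n₁ n₂ ⟩
    εₚ ℤ.* (εₚₑ ℤ.* ((σ ℤ.* n₁) ℤ.* ((σ ℤ.* n₂) ℤ.* e′)))
      ≡⟨ cong₂ (λ l₁ l₂ → εₚ ℤ.* (εₚₑ ℤ.* (l₁ ℤ.* (l₂ ℤ.* e′)))) (L≡σN X) (L≡σN (∁ Y)) ⟨
    εₚ ℤ.* (εₚₑ ℤ.* minor-term S) ∎
    where
    open ≡.≡-Reasoning
    s   = sgnSeq (List._++_ (lst ((X ++ᵛ ⊥ {p}) ++ᵛ S)) (lst ((⊥ {p} ++ᵛ Y) ++ᵛ ∁ S)))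
    n₁  = N (X ++ᵛ S)
    n₂  = N (∁ Y ++ᵛ S)
    e   = ε (lst (∁ Y ++ᵛ S) ++ lst (Y ++ᵛ ∁ S))
    εₚ  = ε Pseq
    εₚₑ = ε (Pseq ++ Eseq)
    e′  = εP ε (lst (∁ Y) ++ lst Y)

  coefficient-degenerate : ∀ S → ¬ (uExponent S ≡ 0 × vExponent S ≡ 0) → 𝐌E-coefficient ε N X Y S ≡ 0ℤ
  coefficient-degenerate S degenerate with N (X ++ᵛ S) ℤ.≟ 0ℤ
  ... | yes n₁≡0 = begin
    s ℤ.* (N (X ++ᵛ S) ℤ.* rest) ≡⟨ cong (λ n₁ → s ℤ.* (n₁ ℤ.* rest)) n₁≡0 ⟩
    s ℤ.* (0ℤ ℤ.* rest)          ≡⟨ cong (s ℤ.*_) (ℤP.*-zeroˡ rest) ⟩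
    s ℤ.* 0ℤ                     ≡⟨ ℤP.*-zeroʳ s ⟩
    0ℤ                           ∎
    where
    open ≡.≡-Reasoning
    s    = sgnSeq (lst ((X ++ᵛ ⊥ {p}) ++ᵛ S) ++ lst ((⊥ {p} ++ᵛ Y) ++ᵛ ∁ S))
    rest = N (∁ Y ++ᵛ S) ℤ.* ε (lst (∁ Y ++ᵛ S) ++ lst (Y ++ᵛ ∁ S))
  ... | no n₁≢0  = contradiction (basis⇒exponents-vanish (proj₁ N-unimodular) X S n₁≢0) degenerate

module Summand {c ℓ : Level} (R : CommutativeRing c ℓ) (p m : ℕ) (ε : List (Fin (p ℕ.+ m)) → ℤ)
               (ε-orientation : GroundSetOrientation ε)
               (N : Subset (p ℕ.+ m) → ℤ) (N-unimodular : UnimodularExtensor N)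
               (g r : Fin m → CommutativeRing.Carrier R)
               (L : Subset m → Subset p → ℤ) (L-minors : ∀ A → UnimodularExtensor (L A) × Ported.PresentsMinor p m N A (L A))
               (X Y : Subset p) where

  open Ported p m
  open OverRing R
  open CommutativeRing R
  open Ext R
  open Arithmetic R
  open Expansion R p m
  open Minor p m N
  open Coefficient p m ε ε-orientation N N-unimodular L L-minors X Y
  open import Relation.Binary.Reasoning.Setoid setoid

  weight powers : Subset m → Carrier
  weight S = ΠL (lst S) g * ΠL (lst (∁ S)) r
  powers S = (0# ^ uExponent S) * (0# ^ vExponent S)

  κ : Carrier
  κ = fromℤ (ε Pseq) * fromℤ (ε (Pseq ++ Eseq))

  coefficient-at : ∀ S → fromℤ (𝐌E-coefficient ε N X Y S) ≈ powers S * (κ * fromℤ (minor-term S))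
  coefficient-at S with uExponent S in u≡ | vExponent S in v≡
  ... | zero | zero = begin
    fromℤ (𝐌E-coefficient ε N X Y S)
      ≡⟨ cong fromℤ (coefficient-nondegenerate S u≡ v≡) ⟩
    fromℤ (ε Pseq ℤ.* (ε (Pseq ++ Eseq) ℤ.* minor-term S))
      ≈⟨ trans (fromℤ-* (ε Pseq) _) (*-congˡ (fromℤ-* (ε (Pseq ++ Eseq)) (minor-term S))) ⟩
    fromℤ (ε Pseq) * (fromℤ (ε (Pseq ++ Eseq)) * fromℤ (minor-term S))
      ≈⟨ *-assoc _ _ _ ⟨
    κ * fromℤ (minor-term S)
      ≈⟨ *-identityˡ _ ⟨
    1# * (κ * fromℤ (minor-term S))
      ≈⟨ *-congʳ (*-identityˡ 1#) ⟨
    (1# * 1#) * (κ * fromℤ (minor-term S)) ∎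
  ... | suc u | v = begin
    fromℤ (𝐌E-coefficient ε N X Y S)
      ≡⟨ cong fromℤ (coefficient-degenerate S (ℕP.1+n≢0 ∘ ≡.trans (≡.sym u≡) ∘ proj₁)) ⟩
    0#
      ≈⟨ zeroˡ _ ⟨
    0# * (κ * fromℤ (minor-term S))
      ≈⟨ *-congʳ (trans (*-congʳ (zeroˡ _)) (zeroˡ _)) ⟨
    ((0# * (0# ^ u)) * (0# ^ v)) * (κ * fromℤ (minor-term S)) ∎
  ... | zero | suc v = begin
    fromℤ (𝐌E-coefficient ε N X Y S)
      ≡⟨ cong fromℤ (coefficient-degenerate S (ℕP.1+n≢0 ∘ ≡.trans (≡.sym v≡) ∘ proj₂)) ⟩
    0#
      ≈⟨ zeroˡ _ ⟨
    0# * (κ * fromℤ (minor-term S))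
      ≈⟨ *-congʳ (trans (*-congˡ (zeroˡ _)) (zeroʳ _)) ⟨
    (1# * (0# * (0# ^ v))) * (κ * fromℤ (minor-term S)) ∎

  summand-at : ∀ S → weight S * fromℤ (𝐌E-coefficient ε N X Y S)
                   ≈ (weight S * powers S) * (κ * 𝐌∅P (εP ε) (L S) (X ++ᵛ Y))
  summand-at S = begin
    weight S * fromℤ (𝐌E-coefficient ε N X Y S)               ≈⟨ *-congˡ (coefficient-at S) ⟩
    weight S * (powers S * (κ * fromℤ (minor-term S)))         ≈⟨ *-assoc _ _ _ ⟨
    (weight S * powers S) * (κ * fromℤ (minor-term S))         ≈⟨ *-congˡ (*-congˡ (𝐌∅P-at (εP ε) (L S) X Y)) ⟨
    (weight S * powers S) * (κ * 𝐌∅P (εP ε) (L S) (X ++ᵛ Y))  ∎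

theorem27 : ∀ {c ℓ : Level} (R : CommutativeRing c ℓ) (p m : ℕ)
    → (ε : List (Fin (p ℕ.+ m)) → ℤ) → GroundSetOrientation ε
    → (N : Subset (p ℕ.+ m) → ℤ) → UnimodularExtensor N
    → (g r : Fin m → CommutativeRing.Carrier R)
    → (L : Subset m → Subset p → ℤ)
    → (∀ A → UnimodularExtensor (L A) × Ported.PresentsMinor p m N A (L A))
    → ∀ C → CommutativeRing._≈_ R (Ported.OverRing.𝐌E p m R ε g r N C) (Ported.OverRing.Rsubst p m R ε g r N L C)
theorem27 R p m ε ε-orientation N N-unimodular g r L L-minors C with Vec.splitAt p C
... | X , Y , ≡.refl = begin
  𝐌E ε g r N (X ++ᵛ Y)
    ≈⟨ 𝐌E-at ε g r N X Y ⟩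
  ΣL (allSubsets m) (λ S → weight S * fromℤ (𝐌E-coefficient ε N X Y S))
    ≈⟨ ΣL-cong (allSubsets m) summand-at ⟩
  ΣL (allSubsets m) (λ S → (weight S * powers S) * (κ * 𝐌∅P (εP ε) (L S) (X ++ᵛ Y)))
    ≡⟨ ΣΛ-at (allSubsets m) _ (X ++ᵛ Y) ⟨
  Rsubst ε g r N L (X ++ᵛ Y) ∎
  where
  open Ported p m
  open OverRing R
  open CommutativeRing R
  open Ext R
  open Arithmetic R
  open Expansion R p m
  open Summand R p m ε ε-orientation N N-unimodular g r L L-minors X Y
  open import Relation.Binary.Reasoning.Setoid setoid
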